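{- Let $n\geq 1$ and let $w_1\geq\cdots\geq w_n\geq 0$ be integers with at least two distinct values among them, and let $d\geq n$ be an integer. Then there exists a tuple of integers $C_1\geq\cdots\geq C_n$ with $$C_1+\cdots+C_n=d\cdot(w_1+\cdots+w_n)+b(\underline{w})-1$$ such that $\mathfrak{BP}(d,\underline{C};\underline{w})$ is $1$-feasible but not feasible.
   Context: Partitioning problem: for integers $w_1\geq\cdots\geq w_n\geq 0$, positive integer $d$ and integer capacities $C_1\geq\cdots\geq C_n$, let $\mathcal{B}$ be the multiset consisting of $d$ balls of weight $w_i$ for each $i=1,\dots,n$. An assignment is a partition $\mathcal{B}=\mathcal{B}_1\sqcup\cdots\sqcup\mathcal{B}_n$ with each $\mathcal{B}_i$ having exactly $d$ balls; $w(\mathcal{B}_i)$ denotes its total weight. $\mathfrak{BP}(d,\underline{C};\underline{w})$ is feasible if some assignment has $w(\mathcal{B}_i)\leq C_i$ for all $i$, and $1$-feasible if some assignment has $w(\mathcal{B}_i)\leq C_i$ for all $i=2,\dots,n$. The constant $b(\lambda)$ for $\lambda=(\lambda_1\geq\cdots\geq\lambda_r\geq 0)$ of length $r$: with conjugate $\lambda'_j=\#\{i:\lambda_i\geq j\}$ ($1\le j\le\lambda_1$), write $\lambda'=(r^{a_0},h_1^{a_1},\dots,h_k^{a_k})$ ($c^a$ = $a$ entries equal to $c$), $a_0\geq0$, $a_1,\dots,a_k>0$, $r>h_1>\cdots>h_k>0$. If $k=0$, $b(\lambda)=0$; otherwise with $h_0=r$, $b(\lambda)=\sum_{t=1}^k(h_{t-1}-h_t)(a_t-1)+(h_k-1)(a_k-1)$.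 Here $b(\underline{w})$ means $b$ of $\lambda=(w_1,\dots,w_n)$ with $r=n$. -}

module Defs where

open import Data.Nat using (ℕ; zero; suc; _+_; _*_; _∸_; _≤_; _≤ᵇ_; _≡ᵇ_; _⊔_)
open import Data.Integer as ℤ using (ℤ; +_)
open import Data.Fin using (Fin; zero; suc; toℕ; _≟_)
open import Data.Product using (_×_; _,_; Σ; ∃)
open import Data.List using (List; []; _∷_; map; foldr; upTo; length; filterᵇ; tabulate)
open import Data.Bool using (Bool; true; false; if_then_else_)
open import Relation.Nullary using (¬_; does)
open import Relation.Binary.PropositionalEquality using (_≡_)

sumℕ : ∀ {n} → (Fin n → ℕ) → ℕ
sumℕ {zero}  f = 0
sumℕ {suc n} f = f zero + sumℕ (λ i → f (suc i))

sumℤ : ∀ {n} → (Fin n → ℤ) → ℤ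
sumℤ {zero}  f = + 0
sumℤ {suc n} f = f zero ℤ.+ sumℤ (λ i → f (suc i))

Antitone : ∀ {a} {A : Set a} (_≤A_ : A → A → Set) {n} → (Fin n → A) → Set
Antitone _≤A_ {n} f = ∀ (i j : Fin n) → toℕ i Data.Nat.≤ toℕ j → f j ≤A f i

conjugate : List ℕ → List ℕ
conjugate λs = map (λ j → length (filterᵇ (λ x → suc j ≤ᵇ x) λs))
                   (upTo (foldr _⊔_ 0 λs))

-- run-length encoding: list of (value, multiplicity) of maximal constant runs
runs : List ℕ → List (ℕ × ℕ)
runs [] = []
runs (x ∷ xs) = ins (runs xs)
  where
  ins : List (ℕ × ℕ) → List (ℕ × ℕ)
  ins [] = (x , 1) ∷ []
  ins ((y , a) ∷ rs) = if x ≡ᵇ y then (y , suc a) ∷ rs else (x , 1) ∷ (y , a) ∷ rs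

-- drop the leading run r^{a_0} (if a_0 > 0)
dropTop : ℕ → List (ℕ × ℕ) → List (ℕ × ℕ)
dropTop r [] = []
dropTop r ((h , a) ∷ rs) = if h ≡ᵇ r then rs else (h , a) ∷ rs

-- Σ_{t=1}^k (h_{t-1} - h_t)(a_t - 1) + (h_k - 1)(a_k - 1), first argument = h_{t-1}
bsum : ℕ → List (ℕ × ℕ) → ℕ
bsum prev [] = 0
bsum prev ((h , a) ∷ []) = (prev ∸ h) * (a ∸ 1) + (h ∸ 1) * (a ∸ 1)
bsum prev ((h , a) ∷ rs@(_ ∷ _)) = (prev ∸ h) * (a ∸ 1) + bsum h rs

-- b(λ) for λ = (λ_1 ≥ ... ≥ λ_r) of length r (k = 0 gives 0)
bPart : List ℕ → ℕ
bPart λs = bsum (length λs) (dropTop (length λs) (runs (conjugate λs)))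

bw : ∀ {n} → (Fin n → ℕ) → ℕ
bw w = bPart (tabulate w)

-- The balls: ball (j , k) is the k-th of the d balls of weight w_j.
Ball : ℕ → ℕ → Set
Ball n d = Fin n × Fin d

inPart : ∀ {n d} → (Ball n d → Fin n) → Fin n → Ball n d → Bool
inPart f i b = does (f b ≟ i)

partSize : ∀ {n d} → (Ball n d → Fin n) → Fin n → ℕ
partSize f i = sumℕ (λ j → sumℕ (λ k → if inPart f i (j , k) then 1 else 0))

IsAssignment : ∀ n d → (Ball n d → Fin n) → Set
IsAssignment n d f = ∀ i → partSize f i ≡ d

partWeight : ∀ {n d} → (Fin n → ℕ) → (Ball n d → Fin n) → Fin n → ℕ
partWeight w f i = sumℕ (λ j → sumℕ (λ k → if inPart f i (j , k) then w j else 0))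

Feasible : ∀ {n} (d : ℕ) → (Fin n → ℤ) → (Fin n → ℕ) → Set
Feasible {n} d C w =
  Σ (Ball n d → Fin n) λ f → IsAssignment n d f ×
    (∀ i → + partWeight w f i ℤ.≤ C i)

-- capacity constraint only for i = 2..n (i.e. toℕ i ≠ 0)
OneFeasible : ∀ {n} (d : ℕ) → (Fin n → ℤ) → (Fin n → ℕ) → Set
OneFeasible {n} d C w =
  Σ (Ball n d → Fin n) λ f → IsAssignment n d f ×
    (∀ i → 1 Data.Nat.≤ toℕ i → + partWeight w f i ℤ.≤ C i)

-- Write top for the largest entry of w, m for the number of its occurrences, v for the largest
-- entry below it and g = top ∸ v. Part i gets C_i + 1 = d w_i + gap_i, where gap_i is the distance
-- from w_i to the next larger entry (0 at the top), and the first part of weight v gets (m − 1) g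
-- more. Adding a new largest entry to w adds one box to every column of the conjugate partition
-- plus some columns of height one; induction along this recursion gives Σ C_i = d Σ w + b(w) − 1.
-- One-feasibility: in m − 1 columns a top part other than the first trades its top ball for the
-- ball of weight v of the first v-part, and then only the first part exceeds its capacity.
-- Infeasibility: by induction on x < v, parts of weight x hold balls of weight x only, since a
-- heavier ball would raise the load to d x + gap = C + 1. So the d m top balls go to parts of
-- weight ≥ v, which take at most d − 1 of them in a top part, m − 1 in the first v-part and none
-- elsewhere; but (d − 1) m + (m − 1) < d m.
module Submission where

open import Defs
open import Data.Bool.Base using (Bool; true; false; if_then_else_)
open import Data.Empty using (⊥; ⊥-elim)
open import Data.Fin.Base using (Fin; zero; suc; toℕ; fromℕ<; inject≤)
open import Data.Fin.Properties using (_≟_; toℕ-injective; toℕ-fromℕ<; toℕ-inject≤; toℕ<n)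
open import Data.Fin.Permutation using (Permutation′; _⟨$⟩ʳ_; _⟨$⟩ˡ_; inverseˡ; inverseʳ; transpose; id)
import Data.Fin.Permutation.Components as PC
open import Data.Integer.Base as ℤ using (ℤ; _⊖_)
import Data.Integer.Properties as ℤ
import Data.Integer.Tactic.RingSolver as ℤSolver
open import Data.List.Base
  using (List; []; _∷_; _++_; map; foldr; length; filterᵇ; replicate; applyUpTo; tabulate)
open import Data.List.Properties
  using (map-upTo; map-applyUpTo; map-++; ++-assoc; ++-identityʳ; map-replicate; length-tabulate)
open import Data.List.Relation.Unary.All using (All; []; _∷_)
open import Data.List.Relation.Unary.All.Properties using (applyUpTo⁺₁)
open import Data.Nat.Base
  using (ℕ; zero; suc; _+_; _*_; _∸_; _≤_; _<_; _⊔_; _⊓_; _≤ᵇ_; _<ᵇ_; _≡ᵇ_; z≤n; s≤s; s≤s⁻¹)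
open import Data.Nat.Properties hiding (_≟_)
open import Data.Nat.Properties using () renaming (_≟_ to _≟ℕ_)
open import Data.Nat.Tactic.RingSolver using (solve-∀)
open import Algebra.Properties.Semiring.Sum +-*-semiring
  using (sum; ∑-distrib-+; ∑-comm; *-distribˡ-sum)
open import Data.Product.Base using (Σ; ∃; _×_; _,_; proj₁; proj₂; map₁)
open import Data.Sum.Base using (_⊎_; inj₁; inj₂)
open import Function.Base using (_∘_; case_of_)
open import Relation.Nullary using (¬_; does; yes; no; ofʸ; ofⁿ)
open import Relation.Nullary.Decidable using (dec-true; dec-false)
open import Relation.Unary using (Decidable)
open import Relation.Binary.Definitions using (tri<; tri≈; tri>)
open import Relation.Binary.PropositionalEquality

-- Finite sums

sumℕ-cong : ∀ {n} {f g : Fin n → ℕ} → (∀ i → f i ≡ g i) → sumℕ f ≡ sumℕ g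
sumℕ-cong {zero}  f≗g = refl
sumℕ-cong {suc n} f≗g = cong₂ _+_ (f≗g zero) (sumℕ-cong (f≗g ∘ suc))

sumℕ≡sum : ∀ {n} (f : Fin n → ℕ) → sumℕ f ≡ sum f
sumℕ≡sum {zero}  f = refl
sumℕ≡sum {suc n} f = cong (f zero +_) (sumℕ≡sum (f ∘ suc))

sumℕ-distrib-+ : ∀ {n} (f g : Fin n → ℕ) → sumℕ (λ i → f i + g i) ≡ sumℕ f + sumℕ g
sumℕ-distrib-+ f g = begin
  sumℕ (λ i → f i + g i) ≡⟨ sumℕ≡sum (λ i → f i + g i) ⟩
  sum (λ i → f i + g i)  ≡⟨ ∑-distrib-+ f g ⟩
  sum f + sum g          ≡⟨ cong₂ _+_ (sumℕ≡sum f) (sumℕ≡sum g) ⟨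
  sumℕ f + sumℕ g        ∎
  where open ≡-Reasoning

*-distribˡ-sumℕ : ∀ {n} c (f : Fin n → ℕ) → c * sumℕ f ≡ sumℕ (λ i → c * f i)
*-distribˡ-sumℕ c f = begin
  c * sumℕ f             ≡⟨ cong (c *_) (sumℕ≡sum f) ⟩
  c * sum f              ≡⟨ *-distribˡ-sum c f ⟩
  sum (λ i → c * f i)    ≡⟨ sumℕ≡sum (λ i → c * f i) ⟨
  sumℕ (λ i → c * f i)   ∎
  where open ≡-Reasoning

sumℕ-comm : ∀ {m n} (F : Fin m → Fin n → ℕ) →
            sumℕ (λ i → sumℕ (F i)) ≡ sumℕ (λ j → sumℕ (λ i → F i j))
sumℕ-comm F = begin
  sumℕ (λ i → sumℕ (F i))          ≡⟨ double F ⟩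
  sum (λ i → sum (F i))            ≡⟨ ∑-comm F ⟩
  sum (λ j → sum (λ i → F i j))    ≡⟨ double (λ j i → F i j) ⟨
  sumℕ (λ j → sumℕ (λ i → F i j))  ∎
  where
  open ≡-Reasoning
  double : ∀ {m n} (G : Fin m → Fin n → ℕ) → sumℕ (λ i → sumℕ (G i)) ≡ sum (λ i → sum (G i))
  double G = trans (sumℕ-cong (λ i → sumℕ≡sum (G i))) (sumℕ≡sum (λ i → sum (G i)))

sumℕ-const : ∀ {n} c → sumℕ {n} (λ _ → c) ≡ n * c
sumℕ-const {zero}  c = refl
sumℕ-const {suc n} c = cong (c +_) (sumℕ-const {n} c)

sumℕ-zero : ∀ {n} {f : Fin n → ℕ} → (∀ i → f i ≡ 0) → sumℕ f ≡ 0
sumℕ-zero {n} f≗0 = trans (sumℕ-cong f≗0) (trans (sumℕ-const {n} 0) (*-zeroʳ n))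

sumℕ-mono : ∀ {n} {f g : Fin n → ℕ} → (∀ i → f i ≤ g i) → sumℕ f ≤ sumℕ g
sumℕ-mono {zero}  f≤g = z≤n
sumℕ-mono {suc n} f≤g = +-mono-≤ (f≤g zero) (sumℕ-mono (f≤g ∘ suc))

sumℕ-mono-excess : ∀ {n} {f g : Fin n → ℕ} → (∀ i → f i ≤ g i) →
                   ∀ i₀ δ → f i₀ + δ ≤ g i₀ → sumℕ f + δ ≤ sumℕ g
sumℕ-mono-excess {suc n} {f} {g} f≤g zero δ p = begin
  f zero + sumℕ (f ∘ suc) + δ    ≡⟨ +-assoc (f zero) _ δ ⟩
  f zero + (sumℕ (f ∘ suc) + δ)  ≡⟨ cong (f zero +_) (+-comm _ δ) ⟩
  f zero + (δ + sumℕ (f ∘ suc))  ≡⟨ +-assoc (f zero) δ _ ⟨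
  f zero + δ + sumℕ (f ∘ suc)    ≤⟨ +-mono-≤ p (sumℕ-mono (f≤g ∘ suc)) ⟩
  g zero + sumℕ (g ∘ suc)        ∎
  where open ≤-Reasoning
sumℕ-mono-excess {suc n} {f} {g} f≤g (suc i₀) δ p = begin
  f zero + sumℕ (f ∘ suc) + δ    ≡⟨ +-assoc (f zero) _ δ ⟩
  f zero + (sumℕ (f ∘ suc) + δ)  ≤⟨ +-mono-≤ (f≤g zero) (sumℕ-mono-excess (f≤g ∘ suc) i₀ δ p) ⟩
  g zero + sumℕ (g ∘ suc)        ∎
  where open ≤-Reasoning

sumℕ-indicator : ∀ {n} (x : Fin n) (h : Fin n → ℕ) → sumℕ (λ i → if does (x ≟ i) then h i else 0) ≡ h x
sumℕ-indicator {suc n} zero    h = trans (cong (h zero +_) (sumℕ-zero {n} (λ _ → refl))) (+-identityʳ _)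
sumℕ-indicator {suc n} (suc x) h = sumℕ-indicator x (h ∘ suc)

count : ∀ {n} → (Fin n → Bool) → ℕ
count P = sumℕ (λ i → if P i then 1 else 0)

count-< : ∀ {n} a → count {n} (λ k → toℕ k <ᵇ a) ≤ a
count-< {zero}  a       = z≤n
count-< {suc n} zero    = ≤-reflexive (sumℕ-zero {n} (λ _ → refl))
count-< {suc n} (suc a) = s≤s (count-< {n} a)

count-prefix : ∀ {n} {P : Fin n → Set} (P? : Decidable P) → (∀ i j → toℕ i ≤ toℕ j → P j → P i) →
               ∀ i → (P i → toℕ i < count (does ∘ P?)) × (toℕ i < count (does ∘ P?) → P i)
count-prefix {suc n} P? down i with P? zero
... | no ¬P0 = (λ Pi → ⊥-elim (¬P0 (down zero i z≤n Pi))) ,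
               (λ i<c → ⊥-elim (<⇒≱ i<c (≤-trans (≤-reflexive (sumℕ-zero tail-empty)) z≤n)))
  where
  tail-empty : ∀ j → (if does (P? (suc j)) then 1 else 0) ≡ 0
  tail-empty j rewrite dec-false (P? (suc j)) (¬P0 ∘ down zero (suc j) z≤n) = refl
count-prefix {suc n} P? down zero    | yes P0 = (λ _ → s≤s z≤n) , (λ _ → P0)
count-prefix {suc n} P? down (suc i) | yes P0
  with count-prefix (P? ∘ suc) (λ a b a≤b → down (suc a) (suc b) (s≤s a≤b)) i
... | into , from = (λ Pi → s≤s (into Pi)) , (λ { (s≤s i<c) → from i<c })

-- Conjugate partitions and run-length encodings

countAbove : ℕ → List ℕ → ℕ
countAbove j xs = length (filterᵇ (λ x → suc j ≤ᵇ x) xs)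

maxList : List ℕ → ℕ
maxList = foldr _⊔_ 0

conjugate≡applyUpTo : ∀ xs → conjugate xs ≡ applyUpTo (λ j → countAbove j xs) (maxList xs)
conjugate≡applyUpTo xs = map-upTo (λ j → countAbove j xs) (maxList xs)

countAbove-∷-< : ∀ {j x} xs → j < x → countAbove j (x ∷ xs) ≡ suc (countAbove j xs)
countAbove-∷-< {j} {x} xs j<x rewrite dec-true (j <? x) j<x = refl

countAbove-≥max : ∀ j xs → maxList xs ≤ j → countAbove j xs ≡ 0
countAbove-≥max j []       _ = refl
countAbove-≥max j (x ∷ xs) p
  rewrite dec-false (j <? x) (λ j<x → <⇒≱ j<x (≤-trans (m≤m⊔n x _) p))
  = countAbove-≥max j xs (≤-trans (m≤n⊔m x _) p)

countAbove-<max : ∀ j xs → j < maxList xs → 1 ≤ countAbove j xs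
countAbove-<max j (x ∷ xs) p with j <? x
... | yes j<x rewrite dec-true (j <? x) j<x = s≤s z≤n
... | no j≮x  rewrite dec-false (j <? x) j≮x =
  countAbove-<max j xs (≰⇒> (λ max≤j → <⇒≱ p (⊔-lub (≮⇒≥ j≮x) max≤j)))

conjugate-positive : ∀ xs → All (1 ≤_) (conjugate xs)
conjugate-positive xs = subst (All (1 ≤_)) (sym (conjugate≡applyUpTo xs))
  (applyUpTo⁺₁ (λ j → countAbove j xs) (maxList xs) (λ {j} → countAbove-<max j xs))

applyUpTo-+ : ∀ (f : ℕ → ℕ) a b → applyUpTo f (a + b) ≡ applyUpTo f a ++ applyUpTo (λ t → f (a + t)) b
applyUpTo-+ f zero    b = refl
applyUpTo-+ f (suc a) b = cong (f 0 ∷_) (applyUpTo-+ (f ∘ suc) a b)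

applyUpTo-cong : ∀ {f g : ℕ → ℕ} n → (∀ {j} → j < n → f j ≡ g j) → applyUpTo f n ≡ applyUpTo g n
applyUpTo-cong zero    f≗g = refl
applyUpTo-cong (suc n) f≗g = cong₂ _∷_ (f≗g (s≤s z≤n)) (applyUpTo-cong n (f≗g ∘ s≤s))

applyUpTo-const : ∀ (c : ℕ) n → applyUpTo (λ _ → c) n ≡ replicate n c
applyUpTo-const c zero    = refl
applyUpTo-const c (suc n) = cong (c ∷_) (applyUpTo-const c n)

conjugate-∷ : ∀ x xs → maxList xs ≤ x →
              conjugate (x ∷ xs) ≡ map suc (conjugate xs) ++ replicate (x ∸ maxList xs) 1
conjugate-∷ x xs M≤x = begin
  conjugate (x ∷ xs)
    ≡⟨ conjugate≡applyUpTo (x ∷ xs) ⟩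
  applyUpTo F (x ⊔ M)
    ≡⟨ cong (applyUpTo F) (trans (m≥n⇒m⊔n≡m M≤x) (sym (m+[n∸m]≡n M≤x))) ⟩
  applyUpTo F (M + (x ∸ M))
    ≡⟨ applyUpTo-+ F M (x ∸ M) ⟩
  applyUpTo F M ++ applyUpTo (λ t → F (M + t)) (x ∸ M)
    ≡⟨ cong₂ _++_ (applyUpTo-cong M low) (applyUpTo-cong (x ∸ M) high) ⟩
  applyUpTo (suc ∘ G) M ++ applyUpTo (λ _ → 1) (x ∸ M)
    ≡⟨ cong₂ _++_ (sym (map-applyUpTo G suc M)) (applyUpTo-const 1 (x ∸ M)) ⟩
  map suc (applyUpTo G M) ++ replicate (x ∸ M) 1
    ≡⟨ cong (λ ys → map suc ys ++ replicate (x ∸ M) 1) (conjugate≡applyUpTo xs) ⟨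
  map suc (conjugate xs) ++ replicate (x ∸ M) 1 ∎
  where
  open ≡-Reasoning
  M = maxList xs
  F = λ j → countAbove j (x ∷ xs)
  G = λ j → countAbove j xs
  low : ∀ {j} → j < M → F j ≡ suc (G j)
  low j<M = countAbove-∷-< xs (<-≤-trans j<M M≤x)
  high : ∀ {t} → t < x ∸ M → F (M + t) ≡ 1
  high {t} t<x∸M = trans (countAbove-∷-< xs (subst (M + t <_) (m+[n∸m]≡n M≤x) (+-monoʳ-< M t<x∸M)))
                         (cong suc (countAbove-≥max (M + t) xs (m≤m+n M t)))

-- The local helper of runs in Defs.
consRun : ℕ → List (ℕ × ℕ) → List (ℕ × ℕ)
consRun x []             = (x , 1) ∷ []
consRun x ((y , a) ∷ rs) = if x ≡ᵇ y then (y , suc a) ∷ rs else (x , 1) ∷ (y , a) ∷ rs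

runs-∷ : ∀ x xs → runs (x ∷ xs) ≡ consRun x (runs xs)
runs-∷ x xs with runs xs
... | []    = refl
... | _ ∷ _ = refl

consRun-nonempty : ∀ x rs → consRun x rs ≢ []
consRun-nonempty x []             ()
consRun-nonempty x ((y , a) ∷ rs) eq with x ≡ᵇ y
consRun-nonempty x ((y , a) ∷ rs) () | true
consRun-nonempty x ((y , a) ∷ rs) () | false

consRun-++ : ∀ x rs qs → rs ≢ [] → consRun x (rs ++ qs) ≡ consRun x rs ++ qs
consRun-++ x []             qs rs≢[] = ⊥-elim (rs≢[] refl)
consRun-++ x ((y , a) ∷ rs) qs _ with x ≡ᵇ y
... | true  = refl
... | false = refl

raise : List (ℕ × ℕ) → List (ℕ × ℕ)
raise = map (map₁ suc)

raise-consRun : ∀ x rs → raise (consRun x rs) ≡ consRun (suc x) (raise rs)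
raise-consRun x []             = refl
raise-consRun x ((y , a) ∷ rs) with x ≡ᵇ y
... | true  = refl
... | false = refl

runs-replicate : ∀ k c → runs (replicate (suc k) c) ≡ (c , suc k) ∷ []
runs-replicate zero    c = refl
runs-replicate (suc k) c
  rewrite runs-∷ c (replicate (suc k) c) | runs-replicate k c | dec-true (c ≟ℕ c) refl = refl

runs-replicate-pos : ∀ k c → 1 ≤ k → runs (replicate k c) ≡ (c , k) ∷ []
runs-replicate-pos (suc k) c _ = runs-replicate k c

-- Positivity keeps the raised runs (heights ≥ 2) from merging with the runs of ones.
runs-raise-++ : ∀ hs k → All (1 ≤_) hs →
                runs (map suc hs ++ replicate k 1) ≡ raise (runs hs) ++ runs (replicate k 1)
runs-raise-++ []               k       _                = refl
runs-raise-++ (h ∷ [])         zero    (s≤s z≤n ∷ _)    = refl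
runs-raise-++ (h ∷ [])         (suc k) (s≤s z≤n ∷ _)    rewrite runs-replicate k 1 = refl
runs-raise-++ (h ∷ hs@(h′ ∷ hs′)) k    (_ ∷ hs-pos)     = begin
  runs (suc h ∷ (map suc hs ++ ones))              ≡⟨ runs-∷ (suc h) (map suc hs ++ ones) ⟩
  consRun (suc h) (runs (map suc hs ++ ones))      ≡⟨ cong (consRun (suc h)) (runs-raise-++ hs k hs-pos) ⟩
  consRun (suc h) (raise (runs hs) ++ runs ones)   ≡⟨ consRun-++ (suc h) (raise (runs hs)) (runs ones) raised≢[] ⟩
  consRun (suc h) (raise (runs hs)) ++ runs ones   ≡⟨ cong (_++ runs ones) (raise-consRun h (runs hs)) ⟨
  raise (consRun h (runs hs)) ++ runs ones         ≡⟨ cong (λ rs → raise rs ++ runs ones) (runs-∷ h hs) ⟨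
  raise (runs (h ∷ hs)) ++ runs ones               ∎
  where
  open ≡-Reasoning
  ones = replicate k 1
  raised≢[] : raise (runs hs) ≢ []
  raised≢[] eq = consRun-nonempty h′ (runs hs′) (trans (sym (runs-∷ h′ hs′)) (map-≡[] eq))
    where
    map-≡[] : ∀ {rs : List (ℕ × ℕ)} → raise rs ≡ [] → rs ≡ []
    map-≡[] {[]} _ = refl

dropTop-raise : ∀ r rs qs → rs ≢ [] → dropTop (suc r) (raise rs ++ qs) ≡ raise (dropTop r rs) ++ qs
dropTop-raise r []             qs rs≢[] = ⊥-elim (rs≢[] refl)
dropTop-raise r ((h , a) ∷ rs) qs _ with h ≡ᵇ r
... | true  = refl
... | false = refl

dropTop-flat : ∀ n y k → dropTop (suc (suc n)) (raise (runs (replicate y (suc n))) ++ (1 , k) ∷ []) ≡ (1 , k) ∷ []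
dropTop-flat n zero    k = refl
dropTop-flat n (suc y) k rewrite runs-replicate y (suc n) | dec-true (n ≟ℕ n) refl = refl

dropTop-nonempty : ∀ r rs ps (p : ℕ × ℕ) → dropTop r rs ≡ ps ++ p ∷ [] → rs ≢ []
dropTop-nonempty r [] []      p () refl
dropTop-nonempty r [] (_ ∷ _) p () refl

bsum-raise : ∀ p rs h a →
             bsum (suc p) (raise rs ++ (suc (suc h) , a) ∷ []) ≡ bsum p (rs ++ (suc h , a) ∷ []) + (a ∸ 1)
bsum-raise p []                       h a = shuffle (p ∸ suc h) (a ∸ 1) h
  where
  shuffle : ∀ x y h → x * y + (y + h * y) ≡ x * y + h * y + y
  shuffle = solve-∀
bsum-raise p ((h₀ , a₀) ∷ [])         h a =
  trans (cong ((p ∸ h₀) * (a₀ ∸ 1) +_) (bsum-raise h₀ [] h a))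
        (sym (+-assoc ((p ∸ h₀) * (a₀ ∸ 1)) (bsum h₀ ((suc h , a) ∷ [])) (a ∸ 1)))
bsum-raise p ((h₀ , a₀) ∷ rs@(_ ∷ _)) h a =
  trans (cong ((p ∸ h₀) * (a₀ ∸ 1) +_) (bsum-raise h₀ rs h a))
        (sym (+-assoc ((p ∸ h₀) * (a₀ ∸ 1)) (bsum h₀ (rs ++ (suc h , a) ∷ [])) (a ∸ 1)))

bsum-++-ones : ∀ p rs h a k →
  bsum p (rs ++ (h , a) ∷ (1 , k) ∷ []) + (h ∸ 1) * (a ∸ 1) ≡ bsum p (rs ++ (h , a) ∷ []) + (h ∸ 1) * (k ∸ 1)
bsum-++-ones p []                       h a k = shuffle ((p ∸ h) * (a ∸ 1)) ((h ∸ 1) * (k ∸ 1)) ((h ∸ 1) * (a ∸ 1))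
  where
  shuffle : ∀ x y z → x + (y + 0) + z ≡ x + z + y
  shuffle = solve-∀
bsum-++-ones p ((h₀ , a₀) ∷ [])         h a k = begin
  c + bsum h₀ ((h , a) ∷ (1 , k) ∷ []) + (h ∸ 1) * (a ∸ 1)   ≡⟨ +-assoc c _ _ ⟩
  c + (bsum h₀ ((h , a) ∷ (1 , k) ∷ []) + (h ∸ 1) * (a ∸ 1)) ≡⟨ cong (c +_) (bsum-++-ones h₀ [] h a k) ⟩
  c + (bsum h₀ ((h , a) ∷ []) + (h ∸ 1) * (k ∸ 1))           ≡⟨ +-assoc c _ _ ⟨
  c + bsum h₀ ((h , a) ∷ []) + (h ∸ 1) * (k ∸ 1)             ∎
  where
  open ≡-Reasoning
  c = (p ∸ h₀) * (a₀ ∸ 1)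
bsum-++-ones p ((h₀ , a₀) ∷ rs@(_ ∷ _)) h a k = begin
  c + bsum h₀ (rs ++ (h , a) ∷ (1 , k) ∷ []) + (h ∸ 1) * (a ∸ 1)   ≡⟨ +-assoc c _ _ ⟩
  c + (bsum h₀ (rs ++ (h , a) ∷ (1 , k) ∷ []) + (h ∸ 1) * (a ∸ 1)) ≡⟨ cong (c +_) (bsum-++-ones h₀ rs h a k) ⟩
  c + (bsum h₀ (rs ++ (h , a) ∷ []) + (h ∸ 1) * (k ∸ 1))           ≡⟨ +-assoc c _ _ ⟨
  c + bsum h₀ (rs ++ (h , a) ∷ []) + (h ∸ 1) * (k ∸ 1)             ∎
  where
  open ≡-Reasoning
  c = (p ∸ h₀) * (a₀ ∸ 1)

-- Order statistics of a tuple

nextAbove : ∀ {n} → (Fin n → ℕ) → ℕ → ℕ → ℕ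
nextAbove {zero}  w x D = D
nextAbove {suc n} w x D = if x <ᵇ w zero then w zero ⊓ nextAbove (w ∘ suc) x D else nextAbove (w ∘ suc) x D

maxBelow : ∀ {n} → (Fin n → ℕ) → ℕ → ℕ
maxBelow {zero}  w t = 0
maxBelow {suc n} w t = (if w zero <ᵇ t then w zero else 0) ⊔ maxBelow (w ∘ suc) t

nextAbove-≤-cap : ∀ {n} (w : Fin n → ℕ) x D → nextAbove w x D ≤ D
nextAbove-≤-cap {zero}  w x D = ≤-refl
nextAbove-≤-cap {suc n} w x D with x <ᵇ w zero
... | true  = ≤-trans (m⊓n≤n _ _) (nextAbove-≤-cap (w ∘ suc) x D)
... | false = nextAbove-≤-cap (w ∘ suc) x D

nextAbove-⊓-cap : ∀ {n} (w : Fin n → ℕ) x D E → nextAbove w x (D ⊓ E) ≡ D ⊓ nextAbove w x E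
nextAbove-⊓-cap {zero}  w x D E = refl
nextAbove-⊓-cap {suc n} w x D E with x <ᵇ w zero
... | false = nextAbove-⊓-cap (w ∘ suc) x D E
... | true  = begin
  w zero ⊓ nextAbove (w ∘ suc) x (D ⊓ E)  ≡⟨ cong (w zero ⊓_) (nextAbove-⊓-cap (w ∘ suc) x D E) ⟩
  w zero ⊓ (D ⊓ N)                       ≡⟨ ⊓-assoc (w zero) D N ⟨
  w zero ⊓ D ⊓ N                         ≡⟨ cong (_⊓ N) (⊓-comm (w zero) D) ⟩
  D ⊓ w zero ⊓ N                         ≡⟨ ⊓-assoc D (w zero) N ⟩
  D ⊓ (w zero ⊓ N)                       ∎
  where
  open ≡-Reasoning
  N = nextAbove (w ∘ suc) x E

nextAbove-≡-cap : ∀ {n} (w : Fin n → ℕ) x D → (∀ j → x < w j → D ≤ w j) → nextAbove w x D ≡ D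
nextAbove-≡-cap {zero}  w x D _ = refl
nextAbove-≡-cap {suc n} w x D D≤ with x <ᵇ w zero | <ᵇ-reflects-< x (w zero)
... | true  | ofʸ x<w₀ = trans (cong (w zero ⊓_) (nextAbove-≡-cap (w ∘ suc) x D (D≤ ∘ suc)))
                              (m≥n⇒m⊓n≡n (D≤ zero x<w₀))
... | false | ofⁿ _    = nextAbove-≡-cap (w ∘ suc) x D (D≤ ∘ suc)

nextAbove-≤ : ∀ {n} (w : Fin n → ℕ) x D j → x < w j → nextAbove w x D ≤ w j
nextAbove-≤ {suc n} w x D zero x<wj rewrite dec-true (x <? w zero) x<wj = m⊓n≤m _ _
nextAbove-≤ {suc n} w x D (suc j) x<wj with x <ᵇ w zero
... | true  = ≤-trans (m⊓n≤n _ _) (nextAbove-≤ (w ∘ suc) x D j x<wj)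
... | false = nextAbove-≤ (w ∘ suc) x D j x<wj

nextAbove-> : ∀ {n} (w : Fin n → ℕ) x D → x < D → x < nextAbove w x D
nextAbove-> {zero}  w x D x<D = x<D
nextAbove-> {suc n} w x D x<D with x <ᵇ w zero | <ᵇ-reflects-< x (w zero)
... | true  | ofʸ x<w₀ = ⊓-glb x<w₀ (nextAbove-> (w ∘ suc) x D x<D)
... | false | ofⁿ _    = nextAbove-> (w ∘ suc) x D x<D

nextAbove-head-cap : ∀ {n} (w : Fin (suc n) → ℕ) x → nextAbove w x (w zero) ≡ nextAbove (w ∘ suc) x (w zero)
nextAbove-head-cap w x with x <ᵇ w zero
... | true  = m≥n⇒m⊓n≡n (nextAbove-≤-cap (w ∘ suc) x (w zero))
... | false = refl

maxBelow-≥ : ∀ {n} (w : Fin n → ℕ) t j → w j < t → w j ≤ maxBelow w t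
maxBelow-≥ {suc n} w t zero    wj<t rewrite dec-true (w zero <? t) wj<t = m≤m⊔n _ _
maxBelow-≥ {suc n} w t (suc j) wj<t = ≤-trans (maxBelow-≥ (w ∘ suc) t j wj<t) (m≤n⊔m _ _)

maxBelow-lub : ∀ {n} (w : Fin n → ℕ) t u → (∀ j → w j < t → w j ≤ u) → maxBelow w t ≤ u
maxBelow-lub {zero}  w t u _ = z≤n
maxBelow-lub {suc n} w t u ≤u with w zero <ᵇ t | <ᵇ-reflects-< (w zero) t
... | true  | ofʸ w₀<t = ⊔-lub (≤u zero w₀<t) (maxBelow-lub (w ∘ suc) t u (≤u ∘ suc))
... | false | ofⁿ _    = ⊔-lub z≤n (maxBelow-lub (w ∘ suc) t u (≤u ∘ suc))

maxBelow-< : ∀ {n} (w : Fin n → ℕ) t → 0 < t → maxBelow w t < t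
maxBelow-< {zero}  w t 0<t = 0<t
maxBelow-< {suc n} w t 0<t with w zero <ᵇ t | <ᵇ-reflects-< (w zero) t
... | true  | ofʸ w₀<t = ⊔-lub w₀<t (maxBelow-< (w ∘ suc) t 0<t)
... | false | ofⁿ _    = ⊔-lub 0<t (maxBelow-< (w ∘ suc) t 0<t)

antitone-tail : ∀ {n} {w : Fin (suc n) → ℕ} → Antitone _≤_ w → Antitone _≤_ (w ∘ suc)
antitone-tail anti i j i≤j = anti (suc i) (suc j) (s≤s i≤j)

distinct⇒below-top : ∀ {n} (w : Fin (suc n) → ℕ) → Antitone _≤_ w →
                     (∃ λ i → ∃ λ j → w i ≢ w j) → ∃ λ j → w j < w zero
distinct⇒below-top w anti (i , j , wi≢wj)
  with m≤n⇒m<n∨m≡n (anti zero i z≤n) | m≤n⇒m<n∨m≡n (anti zero j z≤n)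
... | inj₁ wi<w₀ | _          = i , wi<w₀
... | inj₂ _     | inj₁ wj<w₀ = j , wj<w₀
... | inj₂ wi≡w₀ | inj₂ wj≡w₀ = ⊥-elim (wi≢wj (trans wi≡w₀ (sym wj≡w₀)))

maxList-tabulate : ∀ {n} (w : Fin (suc n) → ℕ) → Antitone _≤_ w → maxList (tabulate w) ≡ w zero
maxList-tabulate {zero}  w anti = ⊔-identityʳ (w zero)
maxList-tabulate {suc n} w anti =
  trans (cong (w zero ⊔_) (maxList-tabulate (w ∘ suc) (antitone-tail anti)))
        (m≥n⇒m⊔n≡m (anti zero (suc zero) z≤n))

isTop : ∀ {n} → (Fin (suc n) → ℕ) → Fin (suc n) → Bool
isTop w j = w j ≡ᵇ w zero

topCount : ∀ {n} → (Fin (suc n) → ℕ) → ℕ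
topCount w = count (isTop w)

topGap : ∀ {n} → (Fin (suc n) → ℕ) → ℕ
topGap w = w zero ∸ maxBelow w (w zero)

gap : ∀ {n} → (Fin (suc n) → ℕ) → Fin (suc n) → ℕ
gap w i = nextAbove w (w i) (w zero) ∸ w i

topCount≡suc : ∀ {n} (w : Fin (suc n) → ℕ) → topCount w ≡ suc (count (isTop w ∘ suc))
topCount≡suc w rewrite dec-true (w zero ≟ℕ w zero) refl = refl

topCount-flat : ∀ {n} (w : Fin (suc n) → ℕ) → (∀ j → w j ≡ w zero) → topCount w ≡ suc n
topCount-flat {n} w flat =
  trans (sumℕ-cong (λ j → cong (if_then 1 else 0) (dec-true (w j ≟ℕ w zero) (flat j))))
        (trans (sumℕ-const {suc n} 1) (*-identityʳ (suc n)))

topGap-pos : ∀ {n} (w : Fin (suc n) → ℕ) → (∃ λ j → w j < w zero) → 1 ≤ topGap w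
topGap-pos w (j , wj<w₀) = m<n⇒0<n∸m (maxBelow-< w (w zero) (≤-<-trans z≤n wj<w₀))

gap-top : ∀ {n} (w : Fin (suc n) → ℕ) i → w i ≡ w zero → gap w i ≡ 0
gap-top w i wi≡w₀ =
  m≤n⇒m∸n≡0 (subst (nextAbove w (w i) (w zero) ≤_) (sym wi≡w₀) (nextAbove-≤-cap w (w i) (w zero)))

gapSum-flat : ∀ {n} (w : Fin (suc n) → ℕ) → (∀ j → w j ≡ w zero) → sumℕ (gap w) ≡ 0
gapSum-flat w flat = sumℕ-zero (λ j → gap-top w j (flat j))

-- b(w) through the conjugate

identity-flat-< : ∀ n g → 1 ≤ g → suc n * (g ∸ 1) + 0 + suc (suc n) + g ≡ 1 * g + (0 + g * suc n) + 1
identity-flat-< n (suc k) _ = shuffle n k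
  where
  shuffle : ∀ n k → suc n * k + 0 + suc (suc n) + suc k ≡ 1 * suc k + (0 + suc k * suc n) + 1
  shuffle = solve-∀

identity-stepped-≡ : ∀ {B B′ N T m} g → 1 ≤ g → B ≡ B′ + (g ∸ 1) →
                     B′ + N + g ≡ m * g + T + 1 → B + suc N + g ≡ suc m * g + T + 1
identity-stepped-≡ {B′ = B′} {N} {T} {m} (suc k) _ refl ih = begin
  B′ + k + suc N + suc k    ≡⟨ shuffle₁ B′ k N ⟩
  B′ + N + suc k + suc k    ≡⟨ cong (_+ suc k) ih ⟩
  m * suc k + T + 1 + suc k ≡⟨ shuffle₂ m k T ⟩
  suc m * suc k + T + 1     ∎
  where
  open ≡-Reasoning
  shuffle₁ : ∀ B k N → B + k + suc N + suc k ≡ B + N + suc k + suc k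
  shuffle₁ = solve-∀
  shuffle₂ : ∀ m k T → m * suc k + T + 1 + suc k ≡ suc m * suc k + T + 1
  shuffle₂ = solve-∀

identity-stepped-< : ∀ {B B′ N T m} g′ g → 1 ≤ g′ → 1 ≤ g →
                     B + m * (g′ ∸ 1) ≡ B′ + (g′ ∸ 1) + m * (g ∸ 1) →
                     B′ + N + g′ ≡ m * g′ + T + 1 → B + suc N + g ≡ 1 * g + (T + g * m) + 1
identity-stepped-< {B} {B′} {N} {T} {m} (suc l) (suc k) _ _ eq ih = +-cancelʳ-≡ (m * l) _ _ (begin
  B + suc N + suc k + m * l                 ≡⟨ shuffle₁ B N k (m * l) ⟩
  (B + m * l) + (N + k + 2)                 ≡⟨ cong (_+ (N + k + 2)) eq ⟩
  (B′ + l + m * k) + (N + k + 2)            ≡⟨ shuffle₂ B′ l m k N ⟩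
  (B′ + N + suc l) + (k + 1 + k * m)        ≡⟨ cong (_+ (k + 1 + k * m)) ih ⟩
  (m * suc l + T + 1) + (k + 1 + k * m)     ≡⟨ shuffle₃ m l T k ⟩
  1 * suc k + (T + suc k * m) + 1 + m * l   ∎)
  where
  open ≡-Reasoning
  shuffle₁ : ∀ B N k X → B + suc N + suc k + X ≡ (B + X) + (N + k + 2)
  shuffle₁ = solve-∀
  shuffle₂ : ∀ B l m k N → (B + l + m * k) + (N + k + 2) ≡ (B + N + suc l) + (k + 1 + k * m)
  shuffle₂ = solve-∀
  shuffle₃ : ∀ m l T k → (m * suc l + T + 1) + (k + 1 + k * m) ≡ 1 * suc k + (T + suc k * m) + 1 + m * l
  shuffle₃ = solve-∀

-- The runs (h₁ , a₁) … (h_k , a_k) of the paper; for non-constant w the last one is (m , g).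
reducedRuns : ∀ {n} → (Fin (suc n) → ℕ) → List (ℕ × ℕ)
reducedRuns {n} w = dropTop (suc n) (runs (conjugate (tabulate w)))

data RunShape {n} (w : Fin (suc n) → ℕ) : Set where
  flat    : (∀ j → w j ≡ w zero) → conjugate (tabulate w) ≡ replicate (w zero) (suc n) → RunShape w
  stepped : (∃ λ j → w j < w zero) → (rs : List (ℕ × ℕ)) →
            reducedRuns w ≡ rs ++ (topCount w , topGap w) ∷ [] →
            bsum (suc n) (reducedRuns w) + suc n + topGap w ≡ topCount w * topGap w + sumℕ (gap w) + 1 →
            RunShape w

module Peel {n} (w : Fin (suc (suc n)) → ℕ) (anti : Antitone _≤_ w) where
  w′ : Fin (suc n) → ℕ
  w′ = w ∘ suc

  x y : ℕ
  x = w zero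
  y = w′ zero

  w′≤y : ∀ j → w′ j ≤ y
  w′≤y j = anti (suc zero) (suc j) (s≤s z≤n)

  topCount-≡ : y ≡ x → topCount w ≡ suc (topCount w′)
  topCount-≡ y≡x = trans (topCount≡suc w) (cong (λ z → suc (count (λ j → w′ j ≡ᵇ z))) (sym y≡x))

  topCount-< : y < x → topCount w ≡ 1
  topCount-< y<x = trans (topCount≡suc w) (cong suc (sumℕ-zero none))
    where
    none : ∀ j → (if w′ j ≡ᵇ x then 1 else 0) ≡ 0
    none j rewrite dec-false (w′ j ≟ℕ x) (<⇒≢ (≤-<-trans (w′≤y j) y<x)) = refl

  maxBelow-x : maxBelow w x ≡ maxBelow w′ x
  maxBelow-x rewrite dec-false (x <? x) (n≮n x) = refl

  topGap-≡ : y ≡ x → topGap w ≡ topGap w′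
  topGap-≡ y≡x = trans (cong (x ∸_) maxBelow-x) (cong (λ z → z ∸ maxBelow w′ z) (sym y≡x))

  topGap-< : y < x → topGap w ≡ x ∸ y
  topGap-< y<x = cong (x ∸_) (trans maxBelow-x
    (≤-antisym (maxBelow-lub w′ x y (λ j _ → w′≤y j)) (maxBelow-≥ w′ x zero y<x)))

  gap-suc : ∀ i → gap w (suc i) ≡ nextAbove w′ (w′ i) x ∸ w′ i
  gap-suc i = cong (_∸ w′ i) (nextAbove-head-cap w (w′ i))

  gapSum : sumℕ (gap w) ≡ sumℕ (λ i → nextAbove w′ (w′ i) x ∸ w′ i)
  gapSum = cong₂ _+_ (gap-top w zero refl) (sumℕ-cong gap-suc)

  gapSum-≡ : y ≡ x → sumℕ (gap w) ≡ sumℕ (gap w′)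
  gapSum-≡ y≡x = trans gapSum (sumℕ-cong (λ i → cong (λ z → nextAbove w′ (w′ i) z ∸ w′ i) (sym y≡x)))

  gap-raised : y < x → ∀ i →
               nextAbove w′ (w′ i) x ∸ w′ i ≡ gap w′ i + (x ∸ y) * (if w′ i ≡ᵇ y then 1 else 0)
  gap-raised y<x i with m≤n⇒m<n∨m≡n (w′≤y i)
  ... | inj₁ w′i<y rewrite dec-false (w′ i ≟ℕ y) (<⇒≢ w′i<y) = begin
    nextAbove w′ (w′ i) x ∸ w′ i        ≡⟨ cong (_∸ w′ i) below-y ⟩
    nextAbove w′ (w′ i) y ∸ w′ i        ≡⟨ +-identityʳ _ ⟨
    gap w′ i + 0                        ≡⟨ cong (gap w′ i +_) (*-zeroʳ (x ∸ y)) ⟨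
    gap w′ i + (x ∸ y) * 0              ∎
    where
    open ≡-Reasoning
    below-y : nextAbove w′ (w′ i) x ≡ nextAbove w′ (w′ i) y
    below-y = sym (trans (cong (nextAbove w′ (w′ i)) (sym (m≤n⇒m⊓n≡m (<⇒≤ y<x))))
                  (trans (nextAbove-⊓-cap w′ (w′ i) y x) (m≥n⇒m⊓n≡n (nextAbove-≤ w′ (w′ i) x zero w′i<y))))
  ... | inj₂ w′i≡y rewrite dec-true (w′ i ≟ℕ y) w′i≡y = begin
    nextAbove w′ (w′ i) x ∸ w′ i        ≡⟨ cong (_∸ w′ i) (nextAbove-≡-cap w′ (w′ i) x nothing-above) ⟩
    x ∸ w′ i                            ≡⟨ cong (x ∸_) w′i≡y ⟩
    x ∸ y                               ≡⟨ *-identityʳ (x ∸ y) ⟨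
    (x ∸ y) * 1                         ≡⟨ cong (_+ (x ∸ y) * 1) (gap-top w′ i w′i≡y) ⟨
    gap w′ i + (x ∸ y) * 1              ∎
    where
    open ≡-Reasoning
    nothing-above : ∀ j → w′ i < w′ j → x ≤ w′ j
    nothing-above j w′i<w′j = ⊥-elim (<⇒≱ w′i<w′j (subst (w′ j ≤_) (sym w′i≡y) (w′≤y j)))

  gapSum-< : y < x → sumℕ (gap w) ≡ sumℕ (gap w′) + (x ∸ y) * topCount w′
  gapSum-< y<x = begin
    sumℕ (gap w)
      ≡⟨ gapSum ⟩
    sumℕ (λ i → nextAbove w′ (w′ i) x ∸ w′ i)
      ≡⟨ sumℕ-cong (gap-raised y<x) ⟩
    sumℕ (λ i → gap w′ i + (x ∸ y) * (if w′ i ≡ᵇ y then 1 else 0))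
      ≡⟨ sumℕ-distrib-+ (gap w′) (λ i → (x ∸ y) * top′ i) ⟩
    sumℕ (gap w′) + sumℕ (λ i → (x ∸ y) * (if w′ i ≡ᵇ y then 1 else 0))
      ≡⟨ cong (sumℕ (gap w′) +_) (*-distribˡ-sumℕ (x ∸ y) top′) ⟨
    sumℕ (gap w′) + (x ∸ y) * topCount w′ ∎
    where
    open ≡-Reasoning
    top′ : Fin (suc n) → ℕ
    top′ i = if w′ i ≡ᵇ y then 1 else 0

  conjugate-step : conjugate (tabulate w) ≡ map suc (conjugate (tabulate w′)) ++ replicate (x ∸ y) 1
  conjugate-step = trans (conjugate-∷ x (tabulate w′) (subst (_≤ x) (sym max′) (anti zero (suc zero) z≤n)))
                         (cong (λ z → map suc (conjugate (tabulate w′)) ++ replicate (x ∸ z) 1) max′)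
    where
    max′ : maxList (tabulate w′) ≡ y
    max′ = maxList-tabulate w′ (antitone-tail anti)

  runs-step : runs (conjugate (tabulate w)) ≡ raise (runs (conjugate (tabulate w′))) ++ runs (replicate (x ∸ y) 1)
  runs-step = trans (cong runs conjugate-step) (runs-raise-++ _ (x ∸ y) (conjugate-positive (tabulate w′)))

  reducedRuns-step : ∀ ps p → reducedRuns w′ ≡ ps ++ p ∷ [] →
                     reducedRuns w ≡ raise ps ++ map₁ suc p ∷ runs (replicate (x ∸ y) 1)
  reducedRuns-step ps p eq = begin
    reducedRuns w
      ≡⟨ cong (dropTop (suc (suc n))) runs-step ⟩
    dropTop (suc (suc n)) (raise rs′ ++ ones)
      ≡⟨ dropTop-raise (suc n) rs′ ones (dropTop-nonempty (suc n) rs′ ps p eq) ⟩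
    raise (reducedRuns w′) ++ ones
      ≡⟨ cong (λ rs → raise rs ++ ones) eq ⟩
    raise (ps ++ p ∷ []) ++ ones
      ≡⟨ cong (_++ ones) (map-++ (map₁ suc) ps (p ∷ [])) ⟩
    (raise ps ++ map₁ suc p ∷ []) ++ ones
      ≡⟨ ++-assoc (raise ps) _ ones ⟩
    raise ps ++ map₁ suc p ∷ ones ∎
    where
    open ≡-Reasoning
    rs′ = runs (conjugate (tabulate w′))
    ones = runs (replicate (x ∸ y) 1)

  mkStepped : ∀ {m g T} → (∃ λ j → w j < x) → ∀ rs →
                topCount w ≡ m → topGap w ≡ g → sumℕ (gap w) ≡ T → reducedRuns w ≡ rs ++ (m , g) ∷ [] →
                bsum (suc (suc n)) (reducedRuns w) + suc (suc n) + g ≡ m * g + T + 1 → RunShape w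
  mkStepped below rs refl refl refl = stepped below rs

  bsum-raised : ∀ ps → reducedRuns w′ ≡ ps ++ (topCount w′ , topGap w′) ∷ [] →
                bsum (suc (suc n)) (raise ps ++ (suc (topCount w′) , topGap w′) ∷ []) ≡
                bsum (suc n) (reducedRuns w′) + (topGap w′ ∸ 1)
  bsum-raised ps shape′ = begin
    bsum (suc (suc n)) (raise ps ++ (suc (topCount w′) , g′) ∷ [])
      ≡⟨ cong (λ m → bsum (suc (suc n)) (raise ps ++ (suc m , g′) ∷ [])) m′≡ ⟩
    bsum (suc (suc n)) (raise ps ++ (suc (suc h) , g′) ∷ [])
      ≡⟨ bsum-raise (suc n) ps h g′ ⟩
    bsum (suc n) (ps ++ (suc h , g′) ∷ []) + (g′ ∸ 1)
      ≡⟨ cong (λ m → bsum (suc n) (ps ++ (m , g′) ∷ []) + (g′ ∸ 1)) m′≡ ⟨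
    bsum (suc n) (ps ++ (topCount w′ , g′) ∷ []) + (g′ ∸ 1)
      ≡⟨ cong (λ rs → bsum (suc n) rs + (g′ ∸ 1)) shape′ ⟨
    bsum (suc n) (reducedRuns w′) + (g′ ∸ 1) ∎
    where
    open ≡-Reasoning
    g′ = topGap w′
    h = count (isTop w′ ∘ suc)
    m′≡ : topCount w′ ≡ suc h
    m′≡ = topCount≡suc w′

  no-ones : y ≡ x → x ∸ y ≡ 0
  no-ones y≡x = trans (cong (x ∸_) y≡x) (n∸n≡0 x)

  extend-≡ : y ≡ x → RunShape w′ → RunShape w
  extend-≡ y≡x (flat flat′ conj′) = flat all-top (begin
    conjugate (tabulate w)
      ≡⟨ conjugate-step ⟩
    map suc (conjugate (tabulate w′)) ++ replicate (x ∸ y) 1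
      ≡⟨ cong₂ (λ c k → map suc c ++ replicate k 1) conj′ (no-ones y≡x) ⟩
    map suc (replicate y (suc n)) ++ []
      ≡⟨ ++-identityʳ _ ⟩
    map suc (replicate y (suc n))
      ≡⟨ map-replicate suc y (suc n) ⟩
    replicate y (suc (suc n))
      ≡⟨ cong (λ k → replicate k (suc (suc n))) y≡x ⟩
    replicate x (suc (suc n)) ∎)
    where
    open ≡-Reasoning
    all-top : ∀ j → w j ≡ x
    all-top zero    = refl
    all-top (suc j) = trans (flat′ j) y≡x
  extend-≡ y≡x (stepped (j , w′j<y) ps shape′ ih) =
    mkStepped (suc j , subst (w′ j <_) y≡x w′j<y) (raise ps)
              (topCount-≡ y≡x) (topGap-≡ y≡x) (gapSum-≡ y≡x) shape
      (identity-stepped-≡ {m = topCount w′} (topGap w′) (topGap-pos w′ (j , w′j<y))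
                          (trans (cong (bsum (suc (suc n))) shape) (bsum-raised ps shape′)) ih)
    where
    shape : reducedRuns w ≡ raise ps ++ (suc (topCount w′) , topGap w′) ∷ []
    shape = trans (reducedRuns-step ps _ shape′)
                  (cong (λ k → raise ps ++ (suc (topCount w′) , topGap w′) ∷ runs (replicate k 1)) (no-ones y≡x))

  extend-< : y < x → RunShape w′ → RunShape w
  extend-< y<x (flat flat′ conj′) =
    mkStepped (suc zero , y<x) [] (topCount-< y<x) (topGap-< y<x) gapSum′ shape
      (trans (cong (λ rs → bsum (suc (suc n)) rs + suc (suc n) + g) shape) (identity-flat-< n g (m<n⇒0<n∸m y<x)))
    where
    open ≡-Reasoning
    g = x ∸ y
    shape : reducedRuns w ≡ (1 , g) ∷ []
    shape = begin
      reducedRuns w                                                               ≡⟨ cong (dropTop (suc (suc n))) runs-step ⟩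
      dropTop (suc (suc n)) (raise (runs (conjugate (tabulate w′))) ++ runs (replicate g 1))
        ≡⟨ cong₂ (λ c r → dropTop (suc (suc n)) (raise (runs c) ++ r)) conj′ (runs-replicate-pos g 1 (m<n⇒0<n∸m y<x)) ⟩
      dropTop (suc (suc n)) (raise (runs (replicate y (suc n))) ++ (1 , g) ∷ [])  ≡⟨ dropTop-flat n y g ⟩
      (1 , g) ∷ []                                                                ∎
    gapSum′ : sumℕ (gap w) ≡ 0 + g * suc n
    gapSum′ = trans (gapSum-< y<x) (cong₂ (λ t m → t + g * m) (gapSum-flat w′ flat′) (topCount-flat w′ flat′))
  extend-< y<x (stepped below′ ps shape′ ih) =
    mkStepped (suc zero , y<x) (raise ps ++ (suc m′ , g′) ∷ []) (topCount-< y<x) (topGap-< y<x) (gapSum-< y<x)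
      (trans shape (sym (++-assoc (raise ps) _ _)))
      (identity-stepped-< g′ g (topGap-pos w′ below′) (m<n⇒0<n∸m y<x) bsum-eq ih)
    where
    open ≡-Reasoning
    m′ = topCount w′
    g′ = topGap w′
    g = x ∸ y
    shape : reducedRuns w ≡ raise ps ++ (suc m′ , g′) ∷ (1 , g) ∷ []
    shape = trans (reducedRuns-step ps _ shape′)
                  (cong (λ r → raise ps ++ (suc m′ , g′) ∷ r) (runs-replicate-pos g 1 (m<n⇒0<n∸m y<x)))
    bsum-eq : bsum (suc (suc n)) (reducedRuns w) + m′ * (g′ ∸ 1) ≡
              bsum (suc n) (reducedRuns w′) + (g′ ∸ 1) + m′ * (g ∸ 1)
    bsum-eq = begin
      bsum (suc (suc n)) (reducedRuns w) + m′ * (g′ ∸ 1)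
        ≡⟨ cong (λ rs → bsum (suc (suc n)) rs + m′ * (g′ ∸ 1)) shape ⟩
      bsum (suc (suc n)) (raise ps ++ (suc m′ , g′) ∷ (1 , g) ∷ []) + m′ * (g′ ∸ 1)
        ≡⟨ bsum-++-ones (suc (suc n)) (raise ps) (suc m′) g′ g ⟩
      bsum (suc (suc n)) (raise ps ++ (suc m′ , g′) ∷ []) + m′ * (g ∸ 1)
        ≡⟨ cong (_+ m′ * (g ∸ 1)) (bsum-raised ps shape′) ⟩
      bsum (suc n) (reducedRuns w′) + (g′ ∸ 1) + m′ * (g ∸ 1) ∎

runShape : ∀ {n} (w : Fin (suc n) → ℕ) → Antitone _≤_ w → RunShape w
runShape {zero}  w _    = flat (λ { zero → refl }) (conjugate-∷ (w zero) [] z≤n)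
runShape {suc n} w anti with m≤n⇒m<n∨m≡n (anti zero (suc zero) z≤n)
... | inj₁ y<x = Peel.extend-< w anti y<x (runShape (w ∘ suc) (antitone-tail anti))
... | inj₂ y≡x = Peel.extend-≡ w anti y≡x (runShape (w ∘ suc) (antitone-tail anti))

bw≡bsum-reducedRuns : ∀ {n} (w : Fin (suc n) → ℕ) → bw w ≡ bsum (suc n) (reducedRuns w)
bw≡bsum-reducedRuns w rewrite length-tabulate w = refl

b-identity : ∀ {n} (w : Fin (suc n) → ℕ) → Antitone _≤_ w → (∃ λ j → w j < w zero) →
             bw w + suc n + topGap w ≡ topCount w * topGap w + sumℕ (gap w) + 1
b-identity w anti (j , wj<w₀) with runShape w anti
... | flat all-top _           = ⊥-elim (<-irrefl (all-top j) wj<w₀)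
... | stepped _ _ _ identity   = trans (cong (λ b → b + _ + topGap w) (bw≡bsum-reducedRuns w)) identity

-- Loads of parts

sumBalls : ∀ {n d} → (Ball n d → ℕ) → ℕ
sumBalls F = sumℕ (λ j → sumℕ (λ k → F (j , k)))

sumBalls-cong : ∀ {n d} {F G : Ball n d → ℕ} → (∀ b → F b ≡ G b) → sumBalls F ≡ sumBalls G
sumBalls-cong F≗G = sumℕ-cong (λ j → sumℕ-cong (λ k → F≗G (j , k)))

sumBalls-mono : ∀ {n d} {F G : Ball n d → ℕ} → (∀ b → F b ≤ G b) → sumBalls F ≤ sumBalls G
sumBalls-mono F≤G = sumℕ-mono (λ j → sumℕ-mono (λ k → F≤G (j , k)))

sumBalls-mono-excess : ∀ {n d} {F G : Ball n d → ℕ} → (∀ b → F b ≤ G b) →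
                       ∀ b₀ δ → F b₀ + δ ≤ G b₀ → sumBalls F + δ ≤ sumBalls G
sumBalls-mono-excess F≤G (j₀ , k₀) δ p =
  sumℕ-mono-excess (λ j → sumℕ-mono (λ k → F≤G (j , k))) j₀ δ
                   (sumℕ-mono-excess (λ k → F≤G (j₀ , k)) k₀ δ p)

sumBalls-distrib-+ : ∀ {n d} (F G : Ball n d → ℕ) → sumBalls (λ b → F b + G b) ≡ sumBalls F + sumBalls G
sumBalls-distrib-+ F G =
  trans (sumℕ-cong (λ j → sumℕ-distrib-+ (λ k → F (j , k)) (λ k → G (j , k))))
        (sumℕ-distrib-+ (λ j → sumℕ (λ k → F (j , k))) (λ j → sumℕ (λ k → G (j , k))))

*-distribˡ-sumBalls : ∀ {n d} c (F : Ball n d → ℕ) → c * sumBalls F ≡ sumBalls (λ b → c * F b)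
*-distribˡ-sumBalls c F =
  trans (*-distribˡ-sumℕ c (λ j → sumℕ (λ k → F (j , k))))
        (sumℕ-cong (λ j → *-distribˡ-sumℕ c (λ k → F (j , k))))

sumℕ-sumBalls-comm : ∀ {m n d} (F : Fin m → Ball n d → ℕ) →
                     sumℕ (λ i → sumBalls (F i)) ≡ sumBalls (λ b → sumℕ (λ i → F i b))
sumℕ-sumBalls-comm F =
  trans (sumℕ-comm (λ i j → sumℕ (λ k → F i (j , k))))
        (sumℕ-cong (λ j → sumℕ-comm (λ i k → F i (j , k))))

sumBalls-rows : ∀ {n} d (h : Fin n → ℕ) → sumBalls {n} {d} (λ b → h (proj₁ b)) ≡ d * sumℕ h
sumBalls-rows d h = trans (sumℕ-cong (λ j → sumℕ-const {d} (h j))) (sym (*-distribˡ-sumℕ d h))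

-- partWeight w f and partSize f are load w f and load (λ _ → 1) f by definition.
load : ∀ {n d} → (Fin n → ℕ) → (Ball n d → Fin n) → Fin n → ℕ
load h f i = sumBalls (λ b → if inPart f i b then h (proj₁ b) else 0)

if-+ : ∀ b (x y : ℕ) → (if b then x + y else 0) ≡ (if b then x else 0) + (if b then y else 0)
if-+ true  x y = refl
if-+ false x y = refl

if-* : ∀ b c (x : ℕ) → c * (if b then x else 0) ≡ (if b then c * x else 0)
if-* true  c x = refl
if-* false c x = *-zeroʳ c

module _ {n d} (f : Ball n d → Fin n) where

  onPart : (Fin n → ℕ) → Fin n → Ball n d → ℕ
  onPart h i b = if inPart f i b then h (proj₁ b) else 0

  inPart-mono : ∀ i b {x y} → (f b ≡ i → x ≤ y) →
                (if inPart f i b then x else 0) ≤ (if inPart f i b then y else 0)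
  inPart-mono i b x≤y with f b ≟ i
  ... | yes fb≡i = x≤y fb≡i
  ... | no _     = z≤n

  load-mono : ∀ {h₁ h₂ : Fin n → ℕ} i → (∀ b → f b ≡ i → h₁ (proj₁ b) ≤ h₂ (proj₁ b)) →
              load h₁ f i ≤ load h₂ f i
  load-mono i h₁≤h₂ = sumBalls-mono (λ b → inPart-mono i b (h₁≤h₂ b))

  load-mono-excess : ∀ {h₁ h₂ : Fin n → ℕ} i → (∀ b → f b ≡ i → h₁ (proj₁ b) ≤ h₂ (proj₁ b)) →
                     ∀ b₀ δ → f b₀ ≡ i → h₁ (proj₁ b₀) + δ ≤ h₂ (proj₁ b₀) → load h₁ f i + δ ≤ load h₂ f i
  load-mono-excess {h₁} {h₂} i h₁≤h₂ b₀ δ fb₀≡i p =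
    sumBalls-mono-excess (λ b → inPart-mono i b (h₁≤h₂ b)) b₀ δ at-b₀
    where
    at-b₀ : (if inPart f i b₀ then h₁ (proj₁ b₀) else 0) + δ ≤ (if inPart f i b₀ then h₂ (proj₁ b₀) else 0)
    at-b₀ rewrite dec-true (f b₀ ≟ i) fb₀≡i = p

  load-distrib-+ : ∀ (h₁ h₂ : Fin n → ℕ) i → load (λ j → h₁ j + h₂ j) f i ≡ load h₁ f i + load h₂ f i
  load-distrib-+ h₁ h₂ i = trans (sumBalls-cong (λ b → if-+ (inPart f i b) (h₁ (proj₁ b)) (h₂ (proj₁ b))))
                                 (sumBalls-distrib-+ (onPart h₁ i) (onPart h₂ i))

  *-distribˡ-load : ∀ c (h : Fin n → ℕ) i → c * load h f i ≡ load (λ j → c * h j) f i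
  *-distribˡ-load c h i =
    trans (*-distribˡ-sumBalls c (onPart h i)) (sumBalls-cong (λ b → if-* (inPart f i b) c (h (proj₁ b))))

  sumℕ-load : ∀ (h : Fin n → ℕ) → sumℕ (λ i → load h f i) ≡ d * sumℕ h
  sumℕ-load h = begin
    sumℕ (λ i → load h f i)
      ≡⟨ sumℕ-sumBalls-comm (onPart h) ⟩
    sumBalls (λ b → sumℕ (λ i → if does (f b ≟ i) then h (proj₁ b) else 0))
      ≡⟨ sumBalls-cong (λ b → sumℕ-indicator (f b) (λ _ → h (proj₁ b))) ⟩
    sumBalls {d = d} (λ b → h (proj₁ b))
      ≡⟨ sumBalls-rows d h ⟩
    d * sumℕ h ∎
    where open ≡-Reasoning

  module _ (assignment : IsAssignment n d f) where

    load-const : ∀ c i → load (λ _ → c) f i ≡ c * d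
    load-const c i = begin
      load (λ _ → c) f i      ≡⟨ sumBalls-cong (λ b → cong (λ x → if inPart f i b then x else 0) (*-identityʳ c)) ⟨
      load (λ _ → c * 1) f i  ≡⟨ *-distribˡ-load c (λ _ → 1) i ⟨
      c * partSize f i        ≡⟨ cong (c *_) (assignment i) ⟩
      c * d                   ∎
      where open ≡-Reasoning

    sumBalls-∘ : ∀ (h : Fin n → ℕ) → sumBalls (λ b → h (f b)) ≡ d * sumℕ h
    sumBalls-∘ h = begin
      sumBalls (λ b → h (f b))
        ≡⟨ sumBalls-cong (λ b → sumℕ-indicator (f b) h) ⟨
      sumBalls (λ b → sumℕ (λ i → if does (f b ≟ i) then h i else 0))
        ≡⟨ sumℕ-sumBalls-comm (λ i → onPart (λ _ → h i) i) ⟨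
      sumℕ (λ i → load (λ _ → h i) f i)
        ≡⟨ sumℕ-cong (λ i → trans (load-const (h i) i) (*-comm (h i) d)) ⟩
      sumℕ (λ i → d * h i)
        ≡⟨ *-distribˡ-sumℕ d h ⟨
      d * sumℕ h ∎
      where open ≡-Reasoning

    -- A class of parts that receives only balls of its own class receives all of them:
    -- both sides count d balls per member of the class.
    assignment-reflects : ∀ {P : Fin n → Set} (P? : Decidable P) →
                          (∀ b → P (f b) → P (proj₁ b)) → ∀ b → P (proj₁ b) → P (f b)
    assignment-reflects {P} P? closed b₀ P-row with P? (f b₀)
    ... | yes P-part = P-part
    ... | no ¬P-part = ⊥-elim (n≮n (sumBalls (χ ∘ f)) (begin-strict
      sumBalls (χ ∘ f)                 <⟨ n<1+n _ ⟩
      suc (sumBalls (χ ∘ f))           ≡⟨ +-comm 1 _ ⟩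
      sumBalls (χ ∘ f) + 1             ≤⟨ sumBalls-mono-excess χf≤χrow b₀ 1 at-b₀ ⟩
      sumBalls {d = d} (χ ∘ proj₁)     ≡⟨ sumBalls-rows d χ ⟩
      d * sumℕ χ                       ≡⟨ sumBalls-∘ χ ⟨
      sumBalls (χ ∘ f)                 ∎))
      where
      open ≤-Reasoning
      χ : Fin n → ℕ
      χ i = if does (P? i) then 1 else 0
      χf≤χrow : ∀ b → χ (f b) ≤ χ (proj₁ b)
      χf≤χrow b with P? (f b)
      ... | yes P-fb rewrite dec-true (P? (proj₁ b)) (closed b P-fb) = ≤-refl
      ... | no _     = z≤n
      at-b₀ : χ (f b₀) + 1 ≤ χ (proj₁ b₀)
      at-b₀ rewrite dec-false (P? (f b₀)) ¬P-part | dec-true (P? (proj₁ b₀)) P-row = ≤-refl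

-- Assignments permuting every column

transpose-fixes : ∀ {n} {a b x : Fin n} → x ≢ a → x ≢ b → PC.transpose a b x ≡ x
transpose-fixes {a = a} {b} {x} x≢a x≢b rewrite dec-false (x ≟ a) x≢a | dec-false (x ≟ b) x≢b = refl

transpose-left : ∀ {n} (a b : Fin n) → PC.transpose a b a ≡ b
transpose-left a b rewrite dec-true (a ≟ a) refl = refl

transpose-right : ∀ {n} (a b : Fin n) → PC.transpose a b b ≡ a
transpose-right a b with b ≟ a
... | yes b≡a = b≡a
... | no _ rewrite dec-true (b ≟ b) refl = refl

columnwise : ∀ {n d} → (Fin d → Permutation′ n) → Ball n d → Fin n
columnwise π (j , k) = π k ⟨$⟩ʳ j

inPart-permutation : ∀ {n} (π : Permutation′ n) j i → does (π ⟨$⟩ʳ j ≟ i) ≡ does (π ⟨$⟩ˡ i ≟ j)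
inPart-permutation π j i with π ⟨$⟩ʳ j ≟ i | π ⟨$⟩ˡ i ≟ j
... | yes _    | yes _    = refl
... | no _     | no _     = refl
... | yes πj≡i | no πi≢j  = ⊥-elim (πi≢j (trans (cong (π ⟨$⟩ˡ_) (sym πj≡i)) (inverseˡ π)))
... | no πj≢i  | yes πi≡j = ⊥-elim (πj≢i (trans (cong (π ⟨$⟩ʳ_) (sym πi≡j)) (inverseʳ π)))

load-columnwise : ∀ {n d} (π : Fin d → Permutation′ n) (h : Fin n → ℕ) i →
                  load h (columnwise π) i ≡ sumℕ (λ k → h (π k ⟨$⟩ˡ i))
load-columnwise π h i = begin
  load h (columnwise π) i
    ≡⟨ sumℕ-comm (λ j k → if does (π k ⟨$⟩ʳ j ≟ i) then h j else 0) ⟩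
  sumℕ (λ k → sumℕ (λ j → if does (π k ⟨$⟩ʳ j ≟ i) then h j else 0))
    ≡⟨ sumℕ-cong (λ k → sumℕ-cong (λ j → cong (λ c → if c then h j else 0) (inPart-permutation (π k) j i))) ⟩
  sumℕ (λ k → sumℕ (λ j → if does (π k ⟨$⟩ˡ i ≟ j) then h j else 0))
    ≡⟨ sumℕ-cong (λ k → sumℕ-indicator (π k ⟨$⟩ˡ i) h) ⟩
  sumℕ (λ k → h (π k ⟨$⟩ˡ i)) ∎
  where open ≡-Reasoning

columnwise-isAssignment : ∀ {n d} (π : Fin d → Permutation′ n) → IsAssignment n d (columnwise π)
columnwise-isAssignment {d = d} π i = trans (load-columnwise π (λ _ → 1) i) (trans (sumℕ-const {d} 1) (*-identityʳ d))

+≤⊖1 : ∀ {a b} → a < b → ℤ.+ a ℤ.≤ b ⊖ 1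
+≤⊖1 {b = suc b} (s≤s a≤b) = ℤ.+≤+ a≤b

+≤⊖1⁻¹ : ∀ {a b} → ℤ.+ a ℤ.≤ b ⊖ 1 → a < b
+≤⊖1⁻¹ {b = zero}  ()
+≤⊖1⁻¹ {b = suc b} (ℤ.+≤+ a≤b) = s≤s a≤b

⊖-+-⊖ : ∀ a b c e → (a ⊖ b) ℤ.+ (c ⊖ e) ≡ (a + c) ⊖ (b + e)
⊖-+-⊖ a b c e = begin
  (a ⊖ b) ℤ.+ (c ⊖ e)                                     ≡⟨ cong₂ ℤ._+_ (ℤ.m-n≡m⊖n a b) (ℤ.m-n≡m⊖n c e) ⟨
  (ℤ.+ a ℤ.- ℤ.+ b) ℤ.+ (ℤ.+ c ℤ.- ℤ.+ e)                 ≡⟨ shuffle (ℤ.+ a) (ℤ.+ b) (ℤ.+ c) (ℤ.+ e) ⟩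
  (ℤ.+ a ℤ.+ ℤ.+ c) ℤ.- (ℤ.+ b ℤ.+ ℤ.+ e)                 ≡⟨ cong₂ ℤ._-_ (ℤ.pos-+ a c) (ℤ.pos-+ b e) ⟨
  ℤ.+ (a + c) ℤ.- ℤ.+ (b + e)                             ≡⟨ ℤ.m-n≡m⊖n (a + c) (b + e) ⟩
  (a + c) ⊖ (b + e)                                       ∎
  where
  open ≡-Reasoning
  shuffle : ∀ (a b c e : ℤ) → (a ℤ.- b) ℤ.+ (c ℤ.- e) ≡ (a ℤ.+ c) ℤ.- (b ℤ.+ e)
  shuffle = ℤSolver.solve-∀

sumℤ-⊖1 : ∀ {n} (a : Fin n → ℕ) → sumℤ (λ i → a i ⊖ 1) ≡ sumℕ a ⊖ n
sumℤ-⊖1 {zero}  a = refl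
sumℤ-⊖1 {suc n} a =
  trans (cong (λ s → (a zero ⊖ 1) ℤ.+ s) (sumℤ-⊖1 (a ∘ suc))) (⊖-+-⊖ (a zero) 1 (sumℕ (a ∘ suc)) n)

⊖-shift : ∀ a b c e → a + c ≡ b + e → a ⊖ e ≡ b ⊖ c
⊖-shift a b c e a+c≡b+e = begin
  a ⊖ e              ≡⟨ ℤ.+-cancelˡ-⊖ c a e ⟨
  (c + a) ⊖ (c + e)  ≡⟨ cong₂ _⊖_ (trans (+-comm c a) (trans a+c≡b+e (+-comm b e))) (+-comm c e) ⟩
  (e + b) ⊖ (e + c)  ≡⟨ ℤ.+-cancelˡ-⊖ e b c ⟩
  b ⊖ c              ∎
  where open ≡-Reasoning

-- The capacities

d*a+b≤d*c : ∀ {d a b c} → 1 ≤ d → a + b ≤ c → d * a + b ≤ d * c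
d*a+b≤d*c {suc d} {a} {b} {c} _ a+b≤c = begin
  a + d * a + b    ≡⟨ shuffle a (d * a) b ⟩
  a + b + d * a    ≤⟨ +-mono-≤ a+b≤c (*-monoʳ-≤ d (≤-trans (m≤m+n a b) a+b≤c)) ⟩
  c + d * c        ∎
  where
  open ≤-Reasoning
  shuffle : ∀ x y z → x + y + z ≡ x + z + y
  shuffle = solve-∀

module Construction {n} (w : Fin (suc n) → ℕ) (anti : Antitone _≤_ w) (below : ∃ λ j → w j < w zero)
                    (d : ℕ) (n<d : suc n ≤ d) where

  top v g m₁ m : ℕ
  top = w zero
  v   = maxBelow w top
  g   = topGap w
  m₁  = count (isTop w ∘ suc)
  m   = suc m₁

  w≤top : ∀ j → w j ≤ top
  w≤top j = anti zero j z≤n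

  v<top : v < top
  v<top = maxBelow-< w top (≤-<-trans z≤n (proj₂ below))

  v+g≡top : v + g ≡ top
  v+g≡top = m+[n∸m]≡n (<⇒≤ v<top)

  g≥1 : 1 ≤ g
  g≥1 = topGap-pos w below

  top-or-below : ∀ i → w i < top ⊎ w i ≡ top
  top-or-below i = m≤n⇒m<n∨m≡n (w≤top i)

  top-prefix : ∀ i → (w i ≡ top → toℕ i < m) × (toℕ i < m → w i ≡ top)
  top-prefix i = subst (λ c → (w i ≡ top → toℕ i < c) × (toℕ i < c → w i ≡ top)) (topCount≡suc w)
    (count-prefix (λ j → w j ≟ℕ top) (λ i j i≤j wj≡top → ≤-antisym (w≤top i) (subst (_≤ w i) wj≡top (anti i j i≤j)))
                  i)

  below-top⇒m≤ : ∀ i → w i < top → m ≤ toℕ i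
  below-top⇒m≤ i wi<top = ≮⇒≥ (λ i<m → <⇒≢ wi<top (proj₂ (top-prefix i) i<m))

  m≤n : m ≤ n
  m≤n = s≤s⁻¹ (≤-<-trans (below-top⇒m≤ (proj₁ below) (proj₂ below)) (toℕ<n (proj₁ below)))

  im : Fin (suc n)
  im = fromℕ< (s≤s m≤n)

  toℕ-im : toℕ im ≡ m
  toℕ-im = toℕ-fromℕ< (s≤s m≤n)

  im-below-top : w im < top
  im-below-top = ≤∧≢⇒< (w≤top im) (λ wim≡top → <⇒≢ (proj₁ (top-prefix im) wim≡top) toℕ-im)

  w-im : w im ≡ v
  w-im = ≤-antisym (maxBelow-≥ w top im im-below-top)
                   (maxBelow-lub w top (w im)
                      (λ j wj<top → anti im j (subst (_≤ toℕ j) (sym toℕ-im) (below-top⇒m≤ j wj<top))))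

  gap-v : ∀ i → w i ≡ v → gap w i ≡ g
  gap-v i wi≡v =
    trans (cong (λ z → nextAbove w z top ∸ z) wi≡v) (cong (_∸ v) (nextAbove-≡-cap w v top only-top-above))
    where
    only-top-above : ∀ j → v < w j → top ≤ w j
    only-top-above j v<wj with top-or-below j
    ... | inj₁ wj<top = ⊥-elim (<⇒≱ v<wj (maxBelow-≥ w top j wj<top))
    ... | inj₂ wj≡top = ≤-reflexive (sym wj≡top)

  gap-pos : ∀ i → w i < top → 1 ≤ gap w i
  gap-pos i wi<top = m<n⇒0<n∸m (nextAbove-> w (w i) top wi<top)

  gap-next : ∀ i j → w i < w j → w i + gap w i ≤ w j
  gap-next i j wi<wj =
    subst (_≤ w j) (sym (m+[n∸m]≡n (<⇒≤ (nextAbove-> w (w i) top (<-≤-trans wi<wj (w≤top j))))))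
          (nextAbove-≤ w (w i) top j wi<wj)

  d≥1 : 1 ≤ d
  d≥1 = ≤-trans (s≤s z≤n) n<d

  base : Fin (suc n) → ℕ
  base i = d * w i + gap w i

  base-mono : ∀ i j → w j ≤ w i → base j ≤ base i
  base-mono i j wj≤wi with m≤n⇒m<n∨m≡n wj≤wi
  ... | inj₁ wj<wi = ≤-trans (d*a+b≤d*c d≥1 (gap-next j i wj<wi)) (m≤m+n (d * w i) (gap w i))
  ... | inj₂ wj≡wi = ≤-reflexive (cong (λ z → d * z + (nextAbove w z top ∸ z)) wj≡wi)

  extra : Fin (suc n) → ℕ
  extra i = if does (im ≟ i) then m₁ * g else 0

  capacity : Fin (suc n) → ℕ
  capacity i = base i + extra i

  capacity-plain : ∀ i → im ≢ i → capacity i ≡ base i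
  capacity-plain i im≢i rewrite dec-false (im ≟ i) im≢i = +-identityʳ (base i)

  base-top : ∀ i → w i ≡ top → base i ≡ d * top
  base-top i wi≡top = begin
    d * w i + gap w i  ≡⟨ cong₂ _+_ (cong (d *_) wi≡top) (gap-top w i wi≡top) ⟩
    d * top + 0        ≡⟨ +-identityʳ (d * top) ⟩
    d * top            ∎
    where open ≡-Reasoning

  im≢top : ∀ i → w i ≡ top → im ≢ i
  im≢top i wi≡top im≡i = <⇒≢ im-below-top (trans (cong w im≡i) wi≡top)

  base-im : base im + m₁ * g ≡ d * v + m * g
  base-im = begin
    d * w im + gap w im + m₁ * g  ≡⟨ cong₂ (λ a b → d * a + b + m₁ * g) w-im (gap-v im w-im) ⟩
    d * v + g + m₁ * g            ≡⟨ +-assoc (d * v) g (m₁ * g) ⟩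
    d * v + m * g                 ∎
    where open ≡-Reasoning

  capacity-im : capacity im ≡ d * v + m * g
  capacity-im rewrite dec-true (im ≟ im) refl = base-im

  base-im-≤-top : base im + m₁ * g ≤ d * top
  base-im-≤-top = begin
    base im + m₁ * g  ≡⟨ base-im ⟩
    d * v + m * g     ≤⟨ +-monoʳ-≤ (d * v) (*-monoˡ-≤ g (≤-trans m≤n (≤-trans (n≤1+n n) n<d))) ⟩
    d * v + d * g     ≡⟨ *-distribˡ-+ d v g ⟨
    d * (v + g)       ≡⟨ cong (d *_) v+g≡top ⟩
    d * top           ∎
    where open ≤-Reasoning

  -- Only the index im carries an extra summand; every index before it is a top index.
  capacity-antitone : Antitone _≤_ capacity
  capacity-antitone i j i≤j with im ≟ j | im ≟ i
  ... | no _     | _        = ≤-trans (≤-reflexive (+-identityʳ (base j)))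
                                      (≤-trans (base-mono i j (anti i j i≤j)) (m≤m+n (base i) _))
  ... | yes im≡j | yes im≡i = ≤-reflexive (cong (λ k → base k + m₁ * g) (trans (sym im≡j) im≡i))
  ... | yes im≡j | no im≢i  = ≤-trans (subst (λ k → base k + m₁ * g ≤ d * top) im≡j base-im-≤-top)
                                      (≤-reflexive (sym (trans (+-identityʳ (base i)) (base-top i (proj₂ (top-prefix i) i<m)))))
    where
    toℕ-j : toℕ j ≡ m
    toℕ-j = trans (cong toℕ (sym im≡j)) toℕ-im
    i<m : toℕ i < m
    i<m = ≤∧≢⇒< (subst (toℕ i ≤_) toℕ-j i≤j)
                (λ i≡m → im≢i (trans im≡j (toℕ-injective (trans toℕ-j (sym i≡m)))))

  C : Fin (suc n) → ℤ
  C i = capacity i ⊖ 1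

  C-antitone : Antitone ℤ._≤_ C
  C-antitone i j i≤j = ℤ.⊖-monoˡ-≤ 1 (capacity-antitone i j i≤j)

  capacity-sum : sumℕ capacity ≡ d * sumℕ w + sumℕ (gap w) + m₁ * g
  capacity-sum = begin
    sumℕ capacity
      ≡⟨ sumℕ-distrib-+ base extra ⟩
    sumℕ base + sumℕ extra
      ≡⟨ cong₂ _+_ (sumℕ-distrib-+ (λ i → d * w i) (gap w)) (sumℕ-indicator im (λ _ → m₁ * g)) ⟩
    sumℕ (λ i → d * w i) + sumℕ (gap w) + m₁ * g
      ≡⟨ cong (λ s → s + sumℕ (gap w) + m₁ * g) (*-distribˡ-sumℕ d w) ⟨
    d * sumℕ w + sumℕ (gap w) + m₁ * g ∎
    where open ≡-Reasoning

  C-sum : sumℤ C ≡ (ℤ.+ (d * sumℕ w) ℤ.+ ℤ.+ bw w) ℤ.- ℤ.+ 1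
  C-sum = begin
    sumℤ C
      ≡⟨ sumℤ-⊖1 capacity ⟩
    sumℕ capacity ⊖ suc n
      ≡⟨ ⊖-shift (sumℕ capacity) (d * sumℕ w + bw w) 1 (suc n) (trans (cong (_+ 1) capacity-sum) total) ⟩
    (d * sumℕ w + bw w) ⊖ 1
      ≡⟨ ℤ.m-n≡m⊖n (d * sumℕ w + bw w) 1 ⟨
    ℤ.+ (d * sumℕ w + bw w) ℤ.- ℤ.+ 1
      ≡⟨ cong (ℤ._- ℤ.+ 1) (ℤ.pos-+ (d * sumℕ w) (bw w)) ⟩
    (ℤ.+ (d * sumℕ w) ℤ.+ ℤ.+ bw w) ℤ.- ℤ.+ 1 ∎
    where
    open ≡-Reasoning
    b-identity′ : bw w + suc n + g ≡ m * g + sumℕ (gap w) + 1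
    b-identity′ = trans (b-identity w anti below) (cong (λ c → c * g + sumℕ (gap w) + 1) (topCount≡suc w))
    total : d * sumℕ w + sumℕ (gap w) + m₁ * g + 1 ≡ d * sumℕ w + bw w + suc n
    total = +-cancelʳ-≡ g _ _ (begin
      d * sumℕ w + sumℕ (gap w) + m₁ * g + 1 + g   ≡⟨ shuffle₁ (d * sumℕ w) (sumℕ (gap w)) m₁ g ⟩
      d * sumℕ w + (m * g + sumℕ (gap w) + 1)      ≡⟨ cong (d * sumℕ w +_) b-identity′ ⟨
      d * sumℕ w + (bw w + suc n + g)              ≡⟨ shuffle₂ (d * sumℕ w) (bw w) (suc n) g ⟩
      d * sumℕ w + bw w + suc n + g                ∎)
      where
      shuffle₁ : ∀ D T k g → D + T + k * g + 1 + g ≡ D + (suc k * g + T + 1)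
      shuffle₁ = solve-∀
      shuffle₂ : ∀ D B N g → D + (B + N + g) ≡ D + B + N + g
      shuffle₂ = solve-∀

  n≤d : n ≤ d
  n≤d = ≤-trans (n≤1+n n) n<d

  swapRow : ∀ {k} → k < m₁ → Fin (suc n)
  swapRow k<m₁ = suc (fromℕ< (<-≤-trans k<m₁ (≤-trans (n≤1+n m₁) m≤n)))

  swapRow-top : ∀ {k} (k<m₁ : k < m₁) → w (swapRow k<m₁) ≡ top
  swapRow-top k<m₁ = proj₂ (top-prefix (swapRow k<m₁)) (s≤s (subst (_< m₁) (sym (toℕ-fromℕ< _)) k<m₁))

  columnSwap : Fin d → Permutation′ (suc n)
  columnSwap k with toℕ k <ᵇ m₁ | <ᵇ-reflects-< (toℕ k) m₁
  ... | true  | ofʸ k<m₁ = transpose (swapRow k<m₁) im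
  ... | false | ofⁿ _    = id

  columnSwap-im : ∀ k → w (columnSwap k ⟨$⟩ˡ im) ≤ v + g * (if toℕ k <ᵇ m₁ then 1 else 0)
  columnSwap-im k with toℕ k <ᵇ m₁ | <ᵇ-reflects-< (toℕ k) m₁
  ... | true  | ofʸ k<m₁ rewrite transpose-left im (swapRow k<m₁) | swapRow-top k<m₁ =
    ≤-reflexive (sym (trans (cong (v +_) (*-identityʳ g)) v+g≡top))
  ... | false | ofⁿ _    = ≤-reflexive (trans w-im (sym (trans (cong (v +_) (*-zeroʳ g)) (+-identityʳ v))))

  columnSwap-top : ∀ i → toℕ i < m₁ → columnSwap (inject≤ i n≤d) ⟨$⟩ˡ suc i ≡ im
  columnSwap-top i i<m₁ with toℕ (inject≤ i n≤d) <ᵇ m₁ | <ᵇ-reflects-< (toℕ (inject≤ i n≤d)) m₁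
  ... | true  | ofʸ k<m₁ =
    subst (λ r → PC.transpose im r (suc i) ≡ im)
          (sym (toℕ-injective (cong suc (trans (toℕ-fromℕ< _) (toℕ-inject≤ i n≤d))))) (transpose-right im (suc i))
  ... | false | ofⁿ k≮m₁ = ⊥-elim (k≮m₁ (subst (_< m₁) (sym (toℕ-inject≤ i n≤d)) i<m₁))

  columnSwap-fixes : ∀ k i → m < toℕ i → columnSwap k ⟨$⟩ˡ i ≡ i
  columnSwap-fixes k i m<i with toℕ k <ᵇ m₁ | <ᵇ-reflects-< (toℕ k) m₁
  ... | true  | ofʸ k<m₁ = transpose-fixes (λ i≡im → <⇒≢ m<i (sym (trans (cong toℕ i≡im) toℕ-im)))
                                           (λ i≡row → <⇒≢ row<i (cong toℕ (sym i≡row)))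
    where
    row<i : toℕ (swapRow k<m₁) < toℕ i
    row<i = <-trans (s≤s (subst (_< m₁) (sym (toℕ-fromℕ< _)) k<m₁)) m<i
  ... | false | ofⁿ _    = refl

  columnLoad : Fin (suc n) → ℕ
  columnLoad i = sumℕ (λ k → w (columnSwap k ⟨$⟩ˡ i))

  top-row-fits : ∀ i → toℕ i < m₁ → columnLoad (suc i) < capacity (suc i)
  top-row-fits i i<m₁ = begin-strict
    columnLoad (suc i)       <⟨ m<m+n (columnLoad (suc i)) g≥1 ⟩
    columnLoad (suc i) + g   ≤⟨ sumℕ-mono-excess (λ k → w≤top _) (inject≤ i n≤d) g traded ⟩
    sumℕ {d} (λ _ → top)     ≡⟨ sumℕ-const {d} top ⟩
    d * top                  ≡⟨ trans (capacity-plain (suc i) (im≢top (suc i) is-top)) (base-top (suc i) is-top) ⟨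
    capacity (suc i)         ∎
    where
    open ≤-Reasoning
    is-top : w (suc i) ≡ top
    is-top = proj₂ (top-prefix (suc i)) (s≤s i<m₁)
    traded : w (columnSwap (inject≤ i n≤d) ⟨$⟩ˡ suc i) + g ≤ top
    traded rewrite columnSwap-top i i<m₁ | w-im = ≤-reflexive v+g≡top

  im-row-fits : columnLoad im < capacity im
  im-row-fits = begin-strict
    columnLoad im
      ≤⟨ sumℕ-mono columnSwap-im ⟩
    sumℕ (λ k → v + g * swapped k)
      ≡⟨ sumℕ-distrib-+ (λ _ → v) (λ k → g * swapped k) ⟩
    sumℕ {d} (λ _ → v) + sumℕ (λ k → g * swapped k)
      ≡⟨ cong₂ _+_ (sumℕ-const {d} v) (sym (*-distribˡ-sumℕ g swapped)) ⟩
    d * v + g * sumℕ swapped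
      ≤⟨ +-monoʳ-≤ (d * v) (*-monoʳ-≤ g (count-< {d} m₁)) ⟩
    d * v + g * m₁
      <⟨ +-monoʳ-< (d * v) (subst (_< m * g) (*-comm m₁ g) (m<n+m (m₁ * g) g≥1)) ⟩
    d * v + m * g
      ≡⟨ capacity-im ⟨
    capacity im ∎
    where
    open ≤-Reasoning
    swapped : Fin d → ℕ
    swapped k = if toℕ k <ᵇ m₁ then 1 else 0

  plain-row-fits : ∀ i → m < toℕ i → columnLoad i < capacity i
  plain-row-fits i m<i = begin-strict
    columnLoad i        ≡⟨ sumℕ-cong (λ k → cong w (columnSwap-fixes k i m<i)) ⟩
    sumℕ {d} (λ _ → w i) ≡⟨ sumℕ-const {d} (w i) ⟩
    d * w i             <⟨ m<m+n (d * w i) (gap-pos i below-top) ⟩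
    base i              ≡⟨ capacity-plain i (λ im≡i → <⇒≢ m<i (sym (trans (cong toℕ (sym im≡i)) toℕ-im))) ⟨
    capacity i          ∎
    where
    open ≤-Reasoning
    below-top : w i < top
    below-top = ≤∧≢⇒< (w≤top i) (λ wi≡top → <⇒≱ (proj₁ (top-prefix i) wi≡top) (<⇒≤ m<i))

  oneFeasible : OneFeasible d C w
  oneFeasible = columnwise columnSwap , columnwise-isAssignment columnSwap ,
                λ i 1≤i → +≤⊖1 (subst (_< capacity i) (sym (load-columnwise columnSwap w i)) (fits i 1≤i))
    where
    fits : ∀ i → 1 ≤ toℕ i → columnLoad i < capacity i
    fits (suc i) _ with <-cmp (toℕ (suc i)) m
    ... | tri< i<m _ _ = top-row-fits i (s≤s⁻¹ i<m)
    ... | tri≈ _ i≡m _ =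
      subst (λ r → columnLoad r < capacity r) (toℕ-injective (trans toℕ-im (sym i≡m))) im-row-fits
    ... | tri> _ _ m<i = plain-row-fits (suc i) m<i

  topIndicator : Fin (suc n) → ℕ
  topIndicator j = if isTop w j then 1 else 0

  topIndicator-top : ∀ i → w i ≡ top → topIndicator i ≡ 1
  topIndicator-top i wi≡top rewrite dec-true (w i ≟ℕ top) wi≡top = refl

  topIndicator-below : ∀ i → w i < top → topIndicator i ≡ 0
  topIndicator-below i wi<top rewrite dec-false (w i ≟ℕ top) (<⇒≢ wi<top) = refl

  imCount : Fin (suc n) → ℕ
  imCount i = if does (im ≟ i) then m₁ else 0

  -- At most this many balls of weight top fit into part i.
  allowance : Fin (suc n) → ℕ
  allowance i = (d ∸ 1) * topIndicator i + imCount i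

  sum-allowance : sumℕ allowance ≡ (d ∸ 1) * m + m₁
  sum-allowance = trans (sumℕ-distrib-+ (λ i → (d ∸ 1) * topIndicator i) imCount)
    (cong₂ _+_ (trans (sym (*-distribˡ-sumℕ (d ∸ 1) topIndicator)) (cong ((d ∸ 1) *_) (topCount≡suc w)))
               (sumℕ-indicator im (λ _ → m₁)))

  imCount-plain : ∀ i → im ≢ i → imCount i ≡ 0
  imCount-plain i im≢i rewrite dec-false (im ≟ i) im≢i = refl

  capacity-heavy : ∀ i → v ≤ w i → capacity i ≡ d * v + suc (allowance i) * g
  capacity-heavy i v≤wi with top-or-below i
  ... | inj₂ wi≡top = begin
    capacity i                       ≡⟨ trans (capacity-plain i (im≢top i wi≡top)) (base-top i wi≡top) ⟩
    d * top                          ≡⟨ cong (d *_) v+g≡top ⟨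
    d * (v + g)                      ≡⟨ *-distribˡ-+ d v g ⟩
    d * v + d * g                    ≡⟨ cong (λ e → d * v + e * g) full ⟨
    d * v + suc (allowance i) * g    ∎
    where
    open ≡-Reasoning
    full : suc (allowance i) ≡ d
    full = begin
      suc ((d ∸ 1) * topIndicator i + imCount i)
        ≡⟨ cong₂ (λ t e → suc ((d ∸ 1) * t + e))
                 (topIndicator-top i wi≡top) (imCount-plain i (im≢top i wi≡top)) ⟩
      suc ((d ∸ 1) * 1 + 0)
        ≡⟨ cong suc (trans (+-identityʳ ((d ∸ 1) * 1)) (*-identityʳ (d ∸ 1))) ⟩
      suc (d ∸ 1)
        ≡⟨ m+[n∸m]≡n d≥1 ⟩
      d ∎
  ... | inj₁ wi<top = case im ≟ i of λ
    { (yes im≡i) → subst (λ k → capacity k ≡ d * v + suc (allowance k) * g) im≡i at-im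
    ; (no im≢i)  → at-plain im≢i }
    where
    open ≡-Reasoning
    wi≡v : w i ≡ v
    wi≡v = ≤-antisym (maxBelow-≥ w top i wi<top) v≤wi
    at-im : capacity im ≡ d * v + suc (allowance im) * g
    at-im rewrite dec-true (im ≟ im) refl | topIndicator-below im im-below-top | *-zeroʳ (d ∸ 1) = base-im
    at-plain : im ≢ i → capacity i ≡ d * v + suc (allowance i) * g
    at-plain im≢i rewrite dec-false (im ≟ i) im≢i | topIndicator-below i wi<top | *-zeroʳ (d ∸ 1) = begin
      base i + 0           ≡⟨ +-identityʳ (base i) ⟩
      d * w i + gap w i    ≡⟨ cong₂ (λ a b → d * a + b) wi≡v (gap-v i wi≡v) ⟩
      d * v + g            ≡⟨ cong (d * v +_) (+-identityʳ g) ⟨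
      d * v + 1 * g        ∎

  module Overfull (f : Ball (suc n) d → Fin (suc n)) (assignment : IsAssignment (suc n) d f)
                  (fits : ∀ i → load w f i < capacity i) where

    -- A heavier ball would add at least gap w i to the load d * x of part i.
    level-pure : ∀ x → x < v → (∀ b → w (f b) < x → w (proj₁ b) ≡ w (f b)) →
                 ∀ b → w (f b) ≡ x → w (proj₁ b) ≡ x
    level-pure x x<v pure b wfb≡x = ≤-antisym (≮⇒≥ not-heavier) (no-lighter b refl)
      where
      i = f b
      lighter-stay : ∀ b′ → w (proj₁ b′) < x → w (f b′) < x
      lighter-stay = assignment-reflects f assignment (λ j → w j <? x)
                       (λ b′ wfb′<x → subst (_< x) (sym (pure b′ wfb′<x)) wfb′<x)
      no-lighter : ∀ b′ → f b′ ≡ i → x ≤ w (proj₁ b′)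
      no-lighter b′ fb′≡i = ≮⇒≥ (λ wrow<x → <⇒≢ (lighter-stay b′ wrow<x) (trans (cong w fb′≡i) wfb≡x))
      im≢i : im ≢ i
      im≢i im≡i = <-irrefl (sym (trans (sym w-im) (trans (cong w im≡i) wfb≡x))) x<v
      not-heavier : ¬ (x < w (proj₁ b))
      not-heavier x<wrow = <⇒≱ (fits i) (begin
        capacity i                     ≡⟨ capacity-plain i im≢i ⟩
        d * w i + gap w i              ≡⟨ cong (_+ gap w i) (trans (cong (d *_) wfb≡x) (*-comm d x)) ⟩
        x * d + gap w i                ≡⟨ cong (_+ gap w i) (load-const f assignment x i) ⟨
        load (λ _ → x) f i + gap w i   ≤⟨ load-mono-excess f {h₁ = λ _ → x} i no-lighter b (gap w i) refl heavier ⟩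
        load w f i                     ∎)
        where
        open ≤-Reasoning
        heavier : x + gap w i ≤ w (proj₁ b)
        heavier = subst (λ z → z + gap w i ≤ w (proj₁ b)) wfb≡x
                        (gap-next i (proj₁ b) (subst (_< w (proj₁ b)) (sym wfb≡x) x<wrow))

    pure-below : ∀ x → x ≤ v → ∀ b → w (f b) < x → w (proj₁ b) ≡ w (f b)
    pure-below zero    _   b ()
    pure-below (suc x) x<v b wfb<1+x with m≤n⇒m<n∨m≡n (s≤s⁻¹ wfb<1+x)
    ... | inj₁ wfb<x = pure-below x (<⇒≤ x<v) b wfb<x
    ... | inj₂ wfb≡x = trans (level-pure x x<v (pure-below x (<⇒≤ x<v)) b wfb≡x) (sym wfb≡x)

    light-stay : ∀ b → w (proj₁ b) < v → w (f b) < v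
    light-stay = assignment-reflects f assignment (λ j → w j <? v)
                   (λ b wfb<v → subst (_< v) (sym (pure-below v ≤-refl b wfb<v)) wfb<v)

    topLoad : Fin (suc n) → ℕ
    topLoad i = load topIndicator f i

    topLoad-light : ∀ i → w i < v → topLoad i ≡ 0
    topLoad-light i wi<v = n≤0⇒n≡0 (≤-trans (load-mono f i no-top) (≤-reflexive (load-const f assignment 0 i)))
      where
      no-top : ∀ b → f b ≡ i → topIndicator (proj₁ b) ≤ 0
      no-top b fb≡i = ≤-reflexive (topIndicator-below (proj₁ b) (<-trans row<v v<top))
        where
        row<v : w (proj₁ b) < v
        row<v = subst (_< v) (sym (pure-below v ≤-refl b (subst (λ k → w k < v) (sym fb≡i) wi<v)))
                      (subst (λ k → w k < v) (sym fb≡i) wi<v)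

    topLoad-heavy : ∀ i → v ≤ w i → d * v + topLoad i * g ≤ load w f i
    topLoad-heavy i v≤wi = begin
      d * v + topLoad i * g
        ≡⟨ cong₂ _+_ (trans (*-comm d v) (sym (load-const f assignment v i)))
                     (trans (*-comm (topLoad i) g) (*-distribˡ-load f g topIndicator i)) ⟩
      load (λ _ → v) f i + load (λ j → g * topIndicator j) f i
        ≡⟨ load-distrib-+ f (λ _ → v) (λ j → g * topIndicator j) i ⟨
      load (λ j → v + g * topIndicator j) f i
        ≤⟨ load-mono f i heavy ⟩
      load w f i ∎
      where
      open ≤-Reasoning
      heavy : ∀ b → f b ≡ i → v + g * topIndicator (proj₁ b) ≤ w (proj₁ b)
      heavy b fb≡i with top-or-below (proj₁ b)
      ... | inj₂ row≡top rewrite topIndicator-top (proj₁ b) row≡top =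
        ≤-reflexive (trans (cong (v +_) (*-identityʳ g)) (trans v+g≡top (sym row≡top)))
      ... | inj₁ row<top rewrite topIndicator-below (proj₁ b) row<top | *-zeroʳ g | +-identityʳ v =
        ≮⇒≥ (λ row<v → <⇒≱ (light-stay b row<v) (subst (λ k → v ≤ w k) (sym fb≡i) v≤wi))

    topLoad-≤-allowance : ∀ i → topLoad i ≤ allowance i
    topLoad-≤-allowance i with w i <? v
    ... | yes wi<v = ≤-trans (≤-reflexive (topLoad-light i wi<v)) z≤n
    ... | no wi≮v  = s≤s⁻¹ (*-cancelʳ-< g (topLoad i) (suc (allowance i))
                             (+-cancelˡ-< (d * v) (topLoad i * g) (suc (allowance i) * g) (begin-strict
      d * v + topLoad i * g           ≤⟨ topLoad-heavy i (≮⇒≥ wi≮v) ⟩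
      load w f i                      <⟨ fits i ⟩
      capacity i                      ≡⟨ capacity-heavy i (≮⇒≥ wi≮v) ⟩
      d * v + suc (allowance i) * g   ∎)))
      where open ≤-Reasoning

    -- The d * m balls of weight top exceed the total allowance (d ∸ 1) * m + m₁.
    absurd : ⊥
    absurd = <⇒≱ (allowance-short d≥1) (begin
      d * m                  ≡⟨ cong (d *_) (topCount≡suc w) ⟨
      d * sumℕ topIndicator  ≡⟨ sumℕ-load f topIndicator ⟨
      sumℕ topLoad           ≤⟨ sumℕ-mono topLoad-≤-allowance ⟩
      sumℕ allowance         ≡⟨ sum-allowance ⟩
      (d ∸ 1) * m + m₁       ∎)
      where
      open ≤-Reasoning
      allowance-short : ∀ {d} → 1 ≤ d → (d ∸ 1) * m + m₁ < d * m
      allowance-short {suc d} _ = ≤-reflexive (cong suc (+-comm (d * m) m₁))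

  infeasible : ¬ Feasible d C w
  infeasible (f , assignment , fits) = Overfull.absurd f assignment (λ i → +≤⊖1⁻¹ (fits i))

theorem1p11 : (n : ℕ) → 1 ≤ n → (w : Fin n → ℕ) → Antitone _≤_ w →
    (∃ λ i → ∃ λ j → w i ≢ w j) → (d : ℕ) → n ≤ d →
    Σ (Fin n → ℤ) λ C → Antitone ℤ._≤_ C ×
      (sumℤ C ≡ (ℤ.+ (d * sumℕ w) ℤ.+ ℤ.+ bw w) ℤ.- ℤ.+ 1) ×
      OneFeasible d C w × ¬ Feasible d C w
theorem1p11 (suc n) _ w anti distinct d n<d = C , C-antitone , C-sum , oneFeasible , infeasible
  where open Construction w anti (distinct⇒below-top w anti distinct) d n<d
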